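{- For any two terms $t,u:\Gamma\vdash A$ of IS4C, the problem whether $\Gamma\vdash t\approx u:A$ is decidable; that is, constructively, for all $t,u$ either $t\approx u$ or $\neg(t\approx u)$.
   Context: Syntax of IS4C. Types $A,B ::= \iota\mid A\Rightarrow B\mid\Box A$. Contexts $\Gamma ::= \cdot\mid\Gamma,A\mid\Gamma,\blacksquare$. Variables: $\mathsf{zero}:(\Gamma,A)\vdash_{var}A$; $\mathsf{succ}\,v:(\Gamma,B)\vdash_{var}A$. OPEs: $\mathsf{base}:\cdot\le\cdot$, $\mathsf{drop}$, $\mathsf{keep}$, $\mathsf{keep}_\blacksquare$; identity $\mathsf{id}$. Accessibility: $\mathsf{nil}:\Gamma\lhd\Gamma$; $\mathsf{ext}\,e:\Delta\lhd(\Gamma,A)$, $\mathsf{lock}\,e:\Delta\lhd(\Gamma,\blacksquare)$ for $e:\Delta\lhd\Gamma$. Composition $e\cdot e'$ for $e:\Delta\lhd\Theta$, $e':\Theta\lhd\Gamma$: $e\cdot\mathsf{nil}=e$, $e\cdot\mathsf{ext}\,e'=\mathsf{ext}(e\cdot e')$, $e\cdot\mathsf{lock}\,e'=\mathsf{lock}(e\cdot e')$; for lock-free $e$, $\mathsf{toOPE}\,\mathsf{nil}=\mathsf{id}$, $\mathsf{toOPE}(\mathsf{ext}\,e)=\mathsf{drop}(\mathsf{toOPE}\,e)$. Terms: $\mathsf{var}$, $\lambda$, $\mathsf{app}$, $\Gamma\vdash\mathsf{box}\,t:\Box A$ for $(\Gamma,\blacksquare)\vdash t:A$, $\Gamma\vdash\mathsf{unbox}(t,e):A$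 for $\Delta\vdash t:\Box A$, $e:\Delta\lhd\Gamma$. Weakening by structural recursion (factoring OPEs through accessibility proofs at $\mathsf{unbox}$). Substitutions: $\mathsf{empty}$, $(s,t)$, $\mathsf{lock}(s,e):\Gamma\vdash_{sub}(\Delta,\blacksquare)$ for $s:\Theta\vdash_{sub}\Delta$, $e:\Theta\lhd\Gamma$; $t[s]$ standard action, $\mathsf{id}_s$ identity. Equivalence $\approx$: least congruence containing $\mathsf{app}(\lambda t,u)\approx t[(\mathsf{id}_s,u)]$; $t\approx\lambda\,\mathsf{app}(\mathsf{wk}(\mathsf{drop}\,\mathsf{id},t),\mathsf{var}\,\mathsf{zero})$; $\mathsf{unbox}(\mathsf{box}\,t,e)\approx t[\mathsf{lock}(\mathsf{id}_s,e)]$; $t\approx\mathsf{box}(\mathsf{unbox}(t,\mathsf{lock}\,\mathsf{nil}))$; $\mathsf{unbox}(t,e\cdot e')\approx\mathsf{unbox}(\mathsf{wk}(\mathsf{toOPE}\,e,t),e')$ for lock-free $e$. -}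

module Defs where

infixr 7 _⇒_
infixl 5 _`,_ _`,🔒

data Ty : Set where
  ι   : Ty
  _⇒_ : Ty → Ty → Ty
  □_  : Ty → Ty

data Ctx : Set where
  ·     : Ctx
  _`,_  : Ctx → Ty → Ctx
  _`,🔒 : Ctx → Ctx

data Var : Ctx → Ty → Set where
  zero : ∀ {Γ A} → Var (Γ `, A) A
  succ : ∀ {Γ A B} → Var Γ A → Var (Γ `, B) A

data _≤_ : Ctx → Ctx → Set where
  base  : · ≤ ·
  drop  : ∀ {Γ Δ A} → Γ ≤ Δ → (Γ `, A) ≤ Δ
  keep  : ∀ {Γ Δ A} → Γ ≤ Δ → (Γ `, A) ≤ (Δ `, A)
  keep🔒 : ∀ {Γ Δ} → Γ ≤ Δ → (Γ `,🔒) ≤ (Δ `,🔒)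

idOPE : ∀ {Γ} → Γ ≤ Γ
idOPE {·}       = base
idOPE {Γ `, A}  = keep idOPE
idOPE {Γ `,🔒}  = keep🔒 idOPE

data _◁_ : Ctx → Ctx → Set where
  nil  : ∀ {Γ} → Γ ◁ Γ
  ext  : ∀ {Δ Γ A} → Δ ◁ Γ → Δ ◁ (Γ `, A)
  lock : ∀ {Δ Γ} → Δ ◁ Γ → Δ ◁ (Γ `,🔒)

_∙_ : ∀ {Δ Θ Γ} → Δ ◁ Θ → Θ ◁ Γ → Δ ◁ Γ
e ∙ nil      = e
e ∙ ext e'   = ext (e ∙ e')
e ∙ lock e'  = lock (e ∙ e')

data LockFree : ∀ {Δ Γ} → Δ ◁ Γ → Set where
  nil : ∀ {Γ} → LockFree (nil {Γ})
  ext : ∀ {Δ Γ A} {e : Δ ◁ Γ} → LockFree e → LockFree (ext {A = A} e)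

toOPE : ∀ {Δ Γ} (e : Δ ◁ Γ) → LockFree e → Γ ≤ Δ
toOPE nil     nil      = idOPE
toOPE (ext e) (ext lf) = drop (toOPE e lf)

data Tm : Ctx → Ty → Set where
  var   : ∀ {Γ A} → Var Γ A → Tm Γ A
  lam   : ∀ {Γ A B} → Tm (Γ `, A) B → Tm Γ (A ⇒ B)
  app   : ∀ {Γ A B} → Tm Γ (A ⇒ B) → Tm Γ A → Tm Γ B
  box   : ∀ {Γ A} → Tm (Γ `,🔒) A → Tm Γ (□ A)
  unbox : ∀ {Γ Δ A} → Tm Δ (□ A) → Δ ◁ Γ → Tm Γ A

factorC : ∀ {Γ' Γ Δ} → Γ' ≤ Γ → Δ ◁ Γ → Ctx
factorC {Γ'} o        nil      = Γ'
factorC      (drop o) (ext e)  = factorC o (ext e)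
factorC      (keep o) (ext e)  = factorC o e
factorC      (drop o) (lock e) = factorC o (lock e)
factorC     (keep🔒 o) (lock e) = factorC o e

factorWk : ∀ {Γ' Γ Δ} (o : Γ' ≤ Γ) (e : Δ ◁ Γ) → factorC o e ≤ Δ
factorWk o        nil      = o
factorWk (drop o) (ext e)  = factorWk o (ext e)
factorWk (keep o) (ext e)  = factorWk o e
factorWk (drop o) (lock e) = factorWk o (lock e)
factorWk (keep🔒 o) (lock e) = factorWk o e

factorExt : ∀ {Γ' Γ Δ} (o : Γ' ≤ Γ) (e : Δ ◁ Γ) → factorC o e ◁ Γ'
factorExt o        nil      = nil
factorExt (drop o) (ext e)  = ext (factorExt o (ext e))
factorExt (keep o) (ext e)  = ext (factorExt o e)
factorExt (drop o) (lock e) = ext (factorExt o (lock e))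
factorExt (keep🔒 o) (lock e) = lock (factorExt o e)

wkVar : ∀ {Γ' Γ A} → Γ' ≤ Γ → Var Γ A → Var Γ' A
wkVar (drop o) v        = succ (wkVar o v)
wkVar (keep o) zero     = zero
wkVar (keep o) (succ v) = succ (wkVar o v)

wk : ∀ {Γ' Γ A} → Γ' ≤ Γ → Tm Γ A → Tm Γ' A
wk o (var v)     = var (wkVar o v)
wk o (lam t)     = lam (wk (keep o) t)
wk o (app t u)   = app (wk o t) (wk o u)
wk o (box t)     = box (wk (keep🔒 o) t)
wk o (unbox t e) = unbox (wk (factorWk o e) t) (factorExt o e)

data Sub : Ctx → Ctx → Set where
  empty : ∀ {Γ} → Sub Γ ·
  _,ₛ_  : ∀ {Γ Δ A} → Sub Γ Δ → Tm Γ A → Sub Γ (Δ `, A)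
  lock  : ∀ {Γ Δ Θ} → Sub Θ Δ → Θ ◁ Γ → Sub Γ (Δ `,🔒)

wkSub : ∀ {Γ' Γ Δ} → Γ' ≤ Γ → Sub Γ Δ → Sub Γ' Δ
wkSub o empty      = empty
wkSub o (s ,ₛ t)   = wkSub o s ,ₛ wk o t
wkSub o (lock s e) = lock (wkSub (factorWk o e) s) (factorExt o e)

factorSC : ∀ {Γ' Γ Δ} → Δ ◁ Γ → Sub Γ' Γ → Ctx
factorSC {Γ'} nil s            = Γ'
factorSC (ext e)  (s ,ₛ t)     = factorSC e s
factorSC (lock e) (lock s e')  = factorSC e s

factorSub : ∀ {Γ' Γ Δ} (e : Δ ◁ Γ) (s : Sub Γ' Γ) → Sub (factorSC e s) Δ
factorSub nil      s           = s
factorSub (ext e)  (s ,ₛ t)    = factorSub e s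
factorSub (lock e) (lock s e') = factorSub e s

factorSExt : ∀ {Γ' Γ Δ} (e : Δ ◁ Γ) (s : Sub Γ' Γ) → factorSC e s ◁ Γ'
factorSExt nil      s           = nil
factorSExt (ext e)  (s ,ₛ t)    = factorSExt e s
factorSExt (lock e) (lock s e') = factorSExt e s ∙ e'

substVar : ∀ {Γ Δ A} → Var Δ A → Sub Γ Δ → Tm Γ A
substVar zero     (s ,ₛ t) = t
substVar (succ v) (s ,ₛ t) = substVar v s

idₛ : ∀ {Γ} → Sub Γ Γ
idₛ {·}      = empty
idₛ {Γ `, A} = wkSub (drop idOPE) idₛ ,ₛ var zero
idₛ {Γ `,🔒} = lock idₛ (lock nil)

_[_] : ∀ {Γ Δ A} → Tm Δ A → Sub Γ Δ → Tm Γ A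
var v     [ s ] = substVar v s
lam t     [ s ] = lam (t [ wkSub (drop idOPE) s ,ₛ var zero ])
app t u   [ s ] = app (t [ s ]) (u [ s ])
box t     [ s ] = box (t [ lock s (lock nil) ])
unbox t e [ s ] = unbox (t [ factorSub e s ]) (factorSExt e s)

infix 4 _≈_
data _≈_ : ∀ {Γ A} → Tm Γ A → Tm Γ A → Set where
  ≈-refl  : ∀ {Γ A} {t : Tm Γ A} → t ≈ t
  ≈-sym   : ∀ {Γ A} {t u : Tm Γ A} → t ≈ u → u ≈ t
  ≈-trans : ∀ {Γ A} {t u v : Tm Γ A} → t ≈ u → u ≈ v → t ≈ v
  cong-lam   : ∀ {Γ A B} {t t' : Tm (Γ `, A) B} → t ≈ t' → lam t ≈ lam t'
  cong-app   : ∀ {Γ A B} {t t' : Tm Γ (A ⇒ B)} {u u' : Tm Γ A}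
             → t ≈ t' → u ≈ u' → app t u ≈ app t' u'
  cong-box   : ∀ {Γ A} {t t' : Tm (Γ `,🔒) A} → t ≈ t' → box t ≈ box t'
  cong-unbox : ∀ {Γ Δ A} {t t' : Tm Δ (□ A)} {e : Δ ◁ Γ}
             → t ≈ t' → unbox t e ≈ unbox t' e
  ⇒-β : ∀ {Γ A B} (t : Tm (Γ `, A) B) (u : Tm Γ A)
      → app (lam t) u ≈ t [ idₛ ,ₛ u ]
  ⇒-η : ∀ {Γ A B} (t : Tm Γ (A ⇒ B))
      → t ≈ lam (app (wk (drop idOPE) t) (var zero))
  □-β : ∀ {Γ Δ A} (t : Tm (Δ `,🔒) A) (e : Δ ◁ Γ)
      → unbox (box t) e ≈ t [ lock idₛ e ]
  □-η : ∀ {Γ A} (t : Tm Γ (□ A))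
      → t ≈ box (unbox t (lock nil))
  shift-unbox : ∀ {Γ Θ Δ A} (t : Tm Δ (□ A)) (e : Δ ◁ Θ) (lf : LockFree e) (e' : Θ ◁ Γ)
      → unbox t (e ∙ e') ≈ unbox (wk (toOPE e lf) t) e'

-- Normalisation by evaluation. Terms are interpreted in a Kripke model whose
-- worlds are contexts, varying along OPEs (weakening) and, for □, along
-- accessibility (a boxed value may be opened behind any further locks), and
-- values are read back as terms. Completeness: convertible terms evaluate to
-- values related by a PER of uniform values, hence have identical normal forms.
-- Soundness: a Kripke logical relation between terms and values gives t ≈ nf t.
-- So t ≈ u iff nf t ≡ nf u, and syntactic equality of terms is decidable.

module Submission where

open import Defs
open import Relation.Nullary using (Dec; yes; no)
open import Relation.Nullary.Decidable using (map′)
open import Relation.Binary.PropositionalEquality hiding ([_]; cong-app)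
open import Data.Product using (Σ-syntax; _×_; _,_; proj₁; proj₂)
open import Function.Base using (flip; _∘_)
open import Relation.Binary.Bundles using (Setoid)
import Relation.Binary.Reasoning.Setoid as SetoidReasoning

infixr 9 _●_
_●_ : ∀ {Γ'' Γ' Γ} → Γ'' ≤ Γ' → Γ' ≤ Γ → Γ'' ≤ Γ
base    ● base    = base
drop o' ● o       = drop (o' ● o)
keep o' ● drop o  = drop (o' ● o)
keep o' ● keep o  = keep (o' ● o)
keep🔒 o' ● keep🔒 o = keep🔒 (o' ● o)

●-identityˡ : ∀ {Γ Δ} (o : Γ ≤ Δ) → idOPE ● o ≡ o
●-identityˡ base      = refl
●-identityˡ (drop o)  = cong drop (●-identityˡ o)
●-identityˡ (keep o)  = cong keep (●-identityˡ o)
●-identityˡ (keep🔒 o) = cong keep🔒 (●-identityˡ o)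

●-identityʳ : ∀ {Γ Δ} (o : Γ ≤ Δ) → o ● idOPE ≡ o
●-identityʳ base      = refl
●-identityʳ (drop o)  = cong drop (●-identityʳ o)
●-identityʳ (keep o)  = cong keep (●-identityʳ o)
●-identityʳ (keep🔒 o) = cong keep🔒 (●-identityʳ o)

●-identity-comm : ∀ {Γ Δ} (o : Γ ≤ Δ) → o ● idOPE ≡ idOPE ● o
●-identity-comm o = trans (●-identityʳ o) (sym (●-identityˡ o))

●-assoc : ∀ {Γ₁ Γ₂ Γ₃ Γ₄} (o₁ : Γ₁ ≤ Γ₂) (o₂ : Γ₂ ≤ Γ₃) (o₃ : Γ₃ ≤ Γ₄) →
          (o₁ ● o₂) ● o₃ ≡ o₁ ● (o₂ ● o₃)
●-assoc base       base       base       = refl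
●-assoc (drop o₁)  o₂         o₃         = cong drop (●-assoc o₁ o₂ o₃)
●-assoc (keep o₁)  (drop o₂)  o₃         = cong drop (●-assoc o₁ o₂ o₃)
●-assoc (keep o₁)  (keep o₂)  (drop o₃)  = cong drop (●-assoc o₁ o₂ o₃)
●-assoc (keep o₁)  (keep o₂)  (keep o₃)  = cong keep (●-assoc o₁ o₂ o₃)
●-assoc (keep🔒 o₁) (keep🔒 o₂) (keep🔒 o₃) = cong keep🔒 (●-assoc o₁ o₂ o₃)

keep-●-drop : ∀ {Γ' Γ A} (o : Γ' ≤ Γ) → keep {A = A} o ● drop idOPE ≡ drop {A = A} idOPE ● o
keep-●-drop o = cong drop (●-identity-comm o)

wkVar-id : ∀ {Γ A} (v : Var Γ A) → wkVar idOPE v ≡ v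
wkVar-id zero     = refl
wkVar-id (succ v) = cong succ (wkVar-id v)

wkVar-● : ∀ {Γ'' Γ' Γ A} (o' : Γ'' ≤ Γ') (o : Γ' ≤ Γ) (v : Var Γ A) →
          wkVar (o' ● o) v ≡ wkVar o' (wkVar o v)
wkVar-● (drop o') o        v        = cong succ (wkVar-● o' o v)
wkVar-● (keep o') (drop o) v        = cong succ (wkVar-● o' o v)
wkVar-● (keep o') (keep o) zero     = refl
wkVar-● (keep o') (keep o) (succ v) = cong succ (wkVar-● o' o v)
wkVar-● base      base     ()
wkVar-● (keep🔒 o') (keep🔒 o) ()

∙-identityˡ : ∀ {Δ Γ} (e : Δ ◁ Γ) → nil ∙ e ≡ e
∙-identityˡ nil      = refl
∙-identityˡ (ext e)  = cong ext (∙-identityˡ e)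
∙-identityˡ (lock e) = cong lock (∙-identityˡ e)

∙-assoc : ∀ {Γ₁ Γ₂ Γ₃ Γ₄} (e₁ : Γ₁ ◁ Γ₂) (e₂ : Γ₂ ◁ Γ₃) (e₃ : Γ₃ ◁ Γ₄) →
          (e₁ ∙ e₂) ∙ e₃ ≡ e₁ ∙ (e₂ ∙ e₃)
∙-assoc e₁ e₂ nil      = refl
∙-assoc e₁ e₂ (ext e₃)  = cong ext (∙-assoc e₁ e₂ e₃)
∙-assoc e₁ e₂ (lock e₃) = cong lock (∙-assoc e₁ e₂ e₃)

-- The left adjoint of □ in the presheaf model: factorising an OPE, a
-- substitution or an environment through an accessibility proof lands in ◆.
record ◆ (P : Ctx → Set) (Γ : Ctx) : Set where
  constructor _,◁_
  field
    {ctx} : Ctx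
    val   : P ctx
    acc   : ctx ◁ Γ
open ◆ public

◆-map : ∀ {P Q Γ} → (∀ {Δ} → P Δ → Q Δ) → ◆ P Γ → ◆ Q Γ
◆-map f g = f (val g) ,◁ acc g

infixl 5 _◆∙_
_◆∙_ : ∀ {P Γ Γ'} → ◆ P Γ → Γ ◁ Γ' → ◆ P Γ'
g ◆∙ e = val g ,◁ (acc g ∙ e)

factor : ∀ {Γ' Γ Δ} → Γ' ≤ Γ → Δ ◁ Γ → ◆ (_≤ Δ) Γ'
factor o e = factorWk o e ,◁ factorExt o e

factor-id : ∀ {Δ Γ} (e : Δ ◁ Γ) → factor idOPE e ≡ (idOPE ,◁ e)
factor-id nil      = refl
factor-id (ext e)  = cong (_◆∙ ext nil) (factor-id e)
factor-id (lock e) = cong (_◆∙ lock nil) (factor-id e)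

factor-● : ∀ {Γ'' Γ' Γ Δ} (o' : Γ'' ≤ Γ') (o : Γ' ≤ Γ) (e : Δ ◁ Γ) →
           factor (o' ● o) e ≡ ◆-map (_● factorWk o e) (factor o' (factorExt o e))
factor-● o'         o         nil      = refl
factor-● (drop o')  (drop o)  (ext e)  = cong (_◆∙ ext nil) (factor-● o' (drop o) (ext e))
factor-● (keep o')  (drop o)  (ext e)  = cong (_◆∙ ext nil) (factor-● o' o (ext e))
factor-● (drop o')  (keep o)  (ext e)  = cong (_◆∙ ext nil) (factor-● o' (keep o) (ext e))
factor-● (keep o')  (keep o)  (ext e)  = cong (_◆∙ ext nil) (factor-● o' o e)
factor-● (drop o')  (drop o)  (lock e) = cong (_◆∙ ext nil) (factor-● o' (drop o) (lock e))
factor-● (keep o')  (drop o)  (lock e) = cong (_◆∙ ext nil) (factor-● o' o (lock e))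
factor-● (drop o')  (keep🔒 o) (lock e) = cong (_◆∙ ext nil) (factor-● o' (keep🔒 o) (lock e))
factor-● (keep🔒 o') (keep🔒 o) (lock e) = cong (_◆∙ lock nil) (factor-● o' o e)

factor-∙ : ∀ {Γ' Γ Θ Δ} (o : Γ' ≤ Γ) (e₁ : Δ ◁ Θ) (e₂ : Θ ◁ Γ) →
           factor o (e₁ ∙ e₂) ≡ factor (factorWk o e₂) e₁ ◆∙ factorExt o e₂
factor-∙ o         e₁ nil       = refl
factor-∙ (drop o)  e₁ (ext e₂)  = cong (_◆∙ ext nil) (factor-∙ o e₁ (ext e₂))
factor-∙ (keep o)  e₁ (ext e₂)  = cong (_◆∙ ext nil) (factor-∙ o e₁ e₂)
factor-∙ (drop o)  e₁ (lock e₂) = cong (_◆∙ ext nil) (factor-∙ o e₁ (lock e₂))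
factor-∙ (keep🔒 o) e₁ (lock e₂) = cong (_◆∙ lock nil) (factor-∙ o e₁ e₂)

factorExt-LockFree : ∀ {Γ' Γ Δ} (o : Γ' ≤ Γ) {e : Δ ◁ Γ} → LockFree e → LockFree (factorExt o e)
factorExt-LockFree o        nil      = nil
factorExt-LockFree (drop o) (ext lf) = ext (factorExt-LockFree o (ext lf))
factorExt-LockFree (keep o) (ext lf) = ext (factorExt-LockFree o lf)

toOPE-factor : ∀ {Θ' Θ Γ} (e : Θ' ◁ Θ) (lf : LockFree e) (o : Γ ≤ Θ) →
               o ● toOPE e lf ≡ toOPE (factorExt o e) (factorExt-LockFree o lf) ● factorWk o e
toOPE-factor nil     nil      o        = ●-identity-comm o
toOPE-factor (ext e) (ext lf) (drop o) = cong drop (toOPE-factor (ext e) (ext lf) o)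
toOPE-factor (ext e) (ext lf) (keep o) = cong drop (toOPE-factor e lf o)

LockFreeFactor : ∀ {W Θ' Θ} → W ◁ Θ' → Θ' ◁ Θ → ◆ (_≤ W) Θ → Set
LockFreeFactor x f g =
  Σ[ k ∈ _ ◁ ctx g ] Σ[ lf ∈ LockFree k ] (x ∙ f ≡ k ∙ acc g) × (toOPE k lf ≡ val g)

factor-toOPE : ∀ {W Θ' Θ} (f : Θ' ◁ Θ) (lf : LockFree f) (x : W ◁ Θ') →
               LockFreeFactor x f (factor (toOPE f lf) x)
factor-toOPE nil     nil      x        =
  subst (LockFreeFactor x nil) (sym (factor-id x)) (nil , nil , sym (∙-identityˡ x) , refl)
factor-toOPE (ext f) (ext lf) nil      = ext f , ext lf , cong ext (∙-identityˡ f) , refl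
factor-toOPE (ext f) (ext lf) (ext x)  with factor-toOPE f lf (ext x)
... | k , lfk , p , q = k , lfk , cong ext p , q
factor-toOPE (ext f) (ext lf) (lock x) with factor-toOPE f lf (lock x)
... | k , lfk , p , q = k , lfk , cong ext p , q

-- Weakening

unboxVia : ∀ {Γ Δ A} → ◆ (_≤ Δ) Γ → Tm Δ (□ A) → Tm Γ A
unboxVia g t = unbox (wk (val g) t) (acc g)

wk-id : ∀ {Γ A} (t : Tm Γ A) → wk idOPE t ≡ t
wk-id (var v)     = cong var (wkVar-id v)
wk-id (lam t)     = cong lam (wk-id t)
wk-id (app t u)   = cong₂ app (wk-id t) (wk-id u)
wk-id (box t)     = cong box (wk-id t)
wk-id (unbox t e) = trans (cong (λ g → unboxVia g t) (factor-id e)) (cong (λ t → unbox t e) (wk-id t))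

wk-● : ∀ {Γ'' Γ' Γ A} (o' : Γ'' ≤ Γ') (o : Γ' ≤ Γ) (t : Tm Γ A) → wk (o' ● o) t ≡ wk o' (wk o t)
wk-● o' o (var v)     = cong var (wkVar-● o' o v)
wk-● o' o (lam t)     = cong lam (wk-● (keep o') (keep o) t)
wk-● o' o (app t u)   = cong₂ app (wk-● o' o t) (wk-● o' o u)
wk-● o' o (box t)     = cong box (wk-● (keep🔒 o') (keep🔒 o) t)
wk-● o' o (unbox t e) =
  trans (cong (λ g → unboxVia g t) (factor-● o' o e))
        (cong (λ t → unbox t (factorExt o' (factorExt o e)))
              (wk-● (factorWk o' (factorExt o e)) (factorWk o e) t))

-- Substitution

lockVia : ∀ {Γ Θ Δ} → ◆ (_≤ Θ) Γ → Sub Θ Δ → Sub Γ (Δ `,🔒)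
lockVia g s = lock (wkSub (val g) s) (acc g)

wkSub-id : ∀ {Γ Δ} (s : Sub Γ Δ) → wkSub idOPE s ≡ s
wkSub-id empty      = refl
wkSub-id (s ,ₛ t)   = cong₂ _,ₛ_ (wkSub-id s) (wk-id t)
wkSub-id (lock s e) = trans (cong (λ g → lockVia g s) (factor-id e)) (cong (λ s → lock s e) (wkSub-id s))

wkSub-● : ∀ {Γ'' Γ' Γ Δ} (o' : Γ'' ≤ Γ') (o : Γ' ≤ Γ) (s : Sub Γ Δ) →
          wkSub (o' ● o) s ≡ wkSub o' (wkSub o s)
wkSub-● o' o empty      = refl
wkSub-● o' o (s ,ₛ t)   = cong₂ _,ₛ_ (wkSub-● o' o s) (wk-● o' o t)
wkSub-● o' o (lock s e) =
  trans (cong (λ g → lockVia g s) (factor-● o' o e))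
        (cong (λ s → lock s (factorExt o' (factorExt o e)))
              (wkSub-● (factorWk o' (factorExt o e)) (factorWk o e) s))

wk-keep-drop : ∀ {Γ' Γ A B} (o : Γ' ≤ Γ) (t : Tm Γ B) →
               wk (keep {A = A} o) (wk (drop idOPE) t) ≡ wk (drop idOPE) (wk o t)
wk-keep-drop o t = begin
  wk (keep o) (wk (drop idOPE) t)   ≡⟨ wk-● (keep o) (drop idOPE) t ⟨
  wk (keep o ● drop idOPE) t        ≡⟨ cong (λ o → wk o t) (keep-●-drop o) ⟩
  wk (drop idOPE ● o) t             ≡⟨ wk-● (drop idOPE) o t ⟩
  wk (drop idOPE) (wk o t)          ∎
  where open ≡-Reasoning

wkSub-keep-drop : ∀ {Γ' Γ Δ A} (o : Γ' ≤ Γ) (s : Sub Γ Δ) →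
                  wkSub (keep {A = A} o) (wkSub (drop idOPE) s) ≡ wkSub (drop idOPE) (wkSub o s)
wkSub-keep-drop o s = begin
  wkSub (keep o) (wkSub (drop idOPE) s)   ≡⟨ wkSub-● (keep o) (drop idOPE) s ⟨
  wkSub (keep o ● drop idOPE) s           ≡⟨ cong (λ o → wkSub o s) (keep-●-drop o) ⟩
  wkSub (drop idOPE ● o) s                ≡⟨ wkSub-● (drop idOPE) o s ⟩
  wkSub (drop idOPE) (wkSub o s)          ∎
  where open ≡-Reasoning

prj : ∀ {Γ Δ' Δ} → Δ' ≤ Δ → Sub Γ Δ' → Sub Γ Δ
prj base      empty      = empty
prj (drop o)  (s ,ₛ t)   = prj o s
prj (keep o)  (s ,ₛ t)   = prj o s ,ₛ t
prj (keep🔒 o) (lock s e) = lock (prj o s) e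

prj-id : ∀ {Γ Δ} (s : Sub Γ Δ) → prj idOPE s ≡ s
prj-id empty      = refl
prj-id (s ,ₛ t)   = cong (_,ₛ t) (prj-id s)
prj-id (lock s e) = cong (λ s → lock s e) (prj-id s)

prj-wkSub : ∀ {Γ' Γ Δ' Δ} (o : Δ' ≤ Δ) (o' : Γ' ≤ Γ) (s : Sub Γ Δ') →
            prj o (wkSub o' s) ≡ wkSub o' (prj o s)
prj-wkSub base      o' empty      = refl
prj-wkSub (drop o)  o' (s ,ₛ t)   = prj-wkSub o o' s
prj-wkSub (keep o)  o' (s ,ₛ t)   = cong (_,ₛ wk o' t) (prj-wkSub o o' s)
prj-wkSub (keep🔒 o) o' (lock s e) = cong (λ s → lock s (factorExt o' e)) (prj-wkSub o (factorWk o' e) s)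

substVar-wkSub : ∀ {Γ' Γ Δ A} (o : Γ' ≤ Γ) (v : Var Δ A) (s : Sub Γ Δ) →
                 substVar v (wkSub o s) ≡ wk o (substVar v s)
substVar-wkSub o zero     (s ,ₛ t) = refl
substVar-wkSub o (succ v) (s ,ₛ t) = substVar-wkSub o v s

substVar-wkVar : ∀ {Γ Δ' Δ A} (o : Δ' ≤ Δ) (v : Var Δ A) (s : Sub Γ Δ') →
                 substVar (wkVar o v) s ≡ substVar v (prj o s)
substVar-wkVar (drop o) v        (s ,ₛ t) = substVar-wkVar o v s
substVar-wkVar (keep o) zero     (s ,ₛ t) = refl
substVar-wkVar (keep o) (succ v) (s ,ₛ t) = substVar-wkVar o v s

factorS : ∀ {Γ' Γ Δ} → Δ ◁ Γ → Sub Γ' Γ → ◆ (flip Sub Δ) Γ'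
factorS e s = factorSub e s ,◁ factorSExt e s

unboxSub : ∀ {Γ Δ A} → ◆ (flip Sub Δ) Γ → Tm Δ (□ A) → Tm Γ A
unboxSub h t = unbox (t [ val h ]) (acc h)

factorS-prj : ∀ {Γ Δ' Δ Δ₀} (o : Δ' ≤ Δ) (e : Δ₀ ◁ Δ) (s : Sub Γ Δ') →
              factorS e (prj o s) ≡ ◆-map (prj (factorWk o e)) (factorS (factorExt o e) s)
factorS-prj o         nil      s           = refl
factorS-prj (drop o)  (ext e)  (s ,ₛ t)    = factorS-prj o (ext e) s
factorS-prj (keep o)  (ext e)  (s ,ₛ t)    = factorS-prj o e s
factorS-prj (drop o)  (lock e) (s ,ₛ t)    = factorS-prj o (lock e) s
factorS-prj (keep🔒 o) (lock e) (lock s e') = cong (_◆∙ e') (factorS-prj o e s)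

factorS-wkSub : ∀ {Γ' Γ Δ Δ₀} (o : Γ' ≤ Γ) (e : Δ₀ ◁ Δ) (s : Sub Γ Δ) →
                factorS e (wkSub o s) ≡ ◆-map (λ w → wkSub w (factorSub e s)) (factor o (factorSExt e s))
factorS-wkSub o nil      s           = refl
factorS-wkSub o (ext e)  (s ,ₛ t)    = factorS-wkSub o e s
factorS-wkSub o (lock e) (lock s e') =
  trans (cong (_◆∙ factorExt o e') (factorS-wkSub (factorWk o e') e s))
        (cong (◆-map (λ w → wkSub w (factorSub e s))) (sym (factor-∙ o (factorSExt e s) e')))

factorS-∙ : ∀ {Γ' Γ Θ Δ} (e₁ : Δ ◁ Θ) (e₂ : Θ ◁ Γ) (s : Sub Γ' Γ) →
            factorS (e₁ ∙ e₂) s ≡ factorS e₁ (factorSub e₂ s) ◆∙ factorSExt e₂ s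
factorS-∙ e₁ nil       s           = refl
factorS-∙ e₁ (ext e₂)  (s ,ₛ t)    = factorS-∙ e₁ e₂ s
factorS-∙ e₁ (lock e₂) (lock s e') =
  trans (cong (_◆∙ e') (factorS-∙ e₁ e₂ s))
        (cong (factorSub e₁ (factorSub e₂ s) ,◁_) (∙-assoc _ _ e'))

[]-wk : ∀ {Γ Δ' Δ A} (o : Δ' ≤ Δ) (t : Tm Δ A) (s : Sub Γ Δ') → wk o t [ s ] ≡ t [ prj o s ]
[]-wk o (var v)     s = substVar-wkVar o v s
[]-wk o (lam t)     s =
  cong lam (trans ([]-wk (keep o) t (wkSub (drop idOPE) s ,ₛ var zero))
                  (cong (λ s' → t [ s' ,ₛ var zero ]) (prj-wkSub o (drop idOPE) s)))
[]-wk o (app t u)   s = cong₂ app ([]-wk o t s) ([]-wk o u s)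
[]-wk o (box t)     s = cong box ([]-wk (keep🔒 o) t (lock s (lock nil)))
[]-wk o (unbox t e) s =
  trans (cong (λ t' → unbox t' (factorSExt (factorExt o e) s))
              ([]-wk (factorWk o e) t (factorSub (factorExt o e) s)))
        (cong (λ h → unboxSub h t) (sym (factorS-prj o e s)))

wk-[] : ∀ {Γ' Γ Δ A} (o : Γ' ≤ Γ) (t : Tm Δ A) (s : Sub Γ Δ) → wk o (t [ s ]) ≡ t [ wkSub o s ]
wk-[] o (var v)     s = sym (substVar-wkSub o v s)
wk-[] o (lam t)     s =
  cong lam (trans (wk-[] (keep o) t (wkSub (drop idOPE) s ,ₛ var zero))
                  (cong (λ s' → t [ s' ,ₛ var zero ]) (wkSub-keep-drop o s)))
wk-[] o (app t u)   s = cong₂ app (wk-[] o t s) (wk-[] o u s)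
wk-[] o (box t)     s = cong box (wk-[] (keep🔒 o) t (lock s (lock nil)))
wk-[] o (unbox t e) s =
  trans (cong (λ t' → unbox t' (factorExt o (factorSExt e s)))
              (wk-[] (factorWk o (factorSExt e s)) t (factorSub e s)))
        (cong (λ h → unboxSub h t) (sym (factorS-wkSub o e s)))

infixl 8 _⊛_
_⊛_ : ∀ {Γ Θ Δ} → Sub Θ Δ → Sub Γ Θ → Sub Γ Δ
empty    ⊛ s' = empty
(s ,ₛ t) ⊛ s' = (s ⊛ s') ,ₛ (t [ s' ])
lock s e ⊛ s' = lock (s ⊛ factorSub e s') (factorSExt e s')

lockSub : ∀ {Γ Δ} → ◆ (flip Sub Δ) Γ → Sub Γ (Δ `,🔒)
lockSub h = lock (val h) (acc h)

wkSub-⊛ : ∀ {Γ Θ' Θ Δ} (o : Θ' ≤ Θ) (s : Sub Θ Δ) (s' : Sub Γ Θ') → wkSub o s ⊛ s' ≡ s ⊛ prj o s'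
wkSub-⊛ o empty      s' = refl
wkSub-⊛ o (s ,ₛ t)   s' = cong₂ _,ₛ_ (wkSub-⊛ o s s') ([]-wk o t s')
wkSub-⊛ o (lock s e) s' =
  trans (cong (λ σ → lock σ (factorSExt (factorExt o e) s'))
              (wkSub-⊛ (factorWk o e) s (factorSub (factorExt o e) s')))
        (cong (λ h → lockSub (◆-map (s ⊛_) h)) (sym (factorS-prj o e s')))

⊛-wkSub : ∀ {Γ' Γ Θ Δ} (o : Γ' ≤ Γ) (s : Sub Θ Δ) (s' : Sub Γ Θ) → s ⊛ wkSub o s' ≡ wkSub o (s ⊛ s')
⊛-wkSub o empty      s' = refl
⊛-wkSub o (s ,ₛ t)   s' = cong₂ _,ₛ_ (⊛-wkSub o s s') (sym (wk-[] o t s'))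
⊛-wkSub o (lock s e) s' =
  trans (cong (λ h → lockSub (◆-map (s ⊛_) h)) (factorS-wkSub o e s'))
        (cong (λ σ → lock σ (factorExt o (factorSExt e s')))
              (⊛-wkSub (factorWk o (factorSExt e s')) s (factorSub e s')))

factorS-⊛ : ∀ {Γ Θ Δ Δ₀} (e : Δ₀ ◁ Δ) (s : Sub Θ Δ) (s' : Sub Γ Θ) →
            factorS e (s ⊛ s') ≡ ◆-map (factorSub e s ⊛_) (factorS (factorSExt e s) s')
factorS-⊛ nil      s            s' = refl
factorS-⊛ (ext e)  (s ,ₛ t)     s' = factorS-⊛ e s s'
factorS-⊛ (lock e) (lock s₀ e₀) s' =
  trans (cong (_◆∙ factorSExt e₀ s') (factorS-⊛ e s₀ (factorSub e₀ s')))
        (cong (◆-map (factorSub e s₀ ⊛_)) (sym (factorS-∙ (factorSExt e s₀) e₀ s')))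

substVar-⊛ : ∀ {Γ Θ Δ A} (v : Var Δ A) (s : Sub Θ Δ) (s' : Sub Γ Θ) →
             substVar v s [ s' ] ≡ substVar v (s ⊛ s')
substVar-⊛ zero     (s ,ₛ t) s' = refl
substVar-⊛ (succ v) (s ,ₛ t) s' = substVar-⊛ v s s'

[]-⊛ : ∀ {Γ Θ Δ A} (t : Tm Δ A) (s : Sub Θ Δ) (s' : Sub Γ Θ) → t [ s ] [ s' ] ≡ t [ s ⊛ s' ]
[]-⊛ (var v)     s s' = substVar-⊛ v s s'
[]-⊛ (lam t)     s s' = cong lam (trans ([]-⊛ t _ _) (cong (λ σ → t [ σ ,ₛ var zero ]) lifted))
  where
  lifted : wkSub (drop idOPE) s ⊛ (wkSub (drop idOPE) s' ,ₛ var zero) ≡ wkSub (drop idOPE) (s ⊛ s')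
  lifted = trans (wkSub-⊛ (drop idOPE) s _) (trans (cong (s ⊛_) (prj-id _)) (⊛-wkSub (drop idOPE) s s'))
[]-⊛ (app t u)   s s' = cong₂ app ([]-⊛ t s s') ([]-⊛ u s s')
[]-⊛ (box t)     s s' = cong box ([]-⊛ t (lock s (lock nil)) (lock s' (lock nil)))
[]-⊛ (unbox t e) s s' =
  trans (cong (λ t' → unbox t' (factorSExt (factorSExt e s) s'))
              ([]-⊛ t (factorSub e s) (factorSub (factorSExt e s) s')))
        (cong (λ h → unboxSub h t) (sym (factorS-⊛ e s s')))

prj-idₛ : ∀ {Γ' Γ} (o : Γ' ≤ Γ) → prj o idₛ ≡ wkSub o idₛ
prj-idₛ base      = refl
prj-idₛ (drop o)  = begin
  prj o (wkSub (drop idOPE) idₛ)   ≡⟨ prj-wkSub o (drop idOPE) idₛ ⟩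
  wkSub (drop idOPE) (prj o idₛ)   ≡⟨ cong (wkSub (drop idOPE)) (prj-idₛ o) ⟩
  wkSub (drop idOPE) (wkSub o idₛ) ≡⟨ wkSub-● (drop idOPE) o idₛ ⟨
  wkSub (drop (idOPE ● o)) idₛ     ≡⟨ cong (λ o' → wkSub (drop o') idₛ) (●-identityˡ o) ⟩
  wkSub (drop o) idₛ               ∎
  where open ≡-Reasoning
prj-idₛ (keep o)  = cong (_,ₛ var zero) (begin
  prj o (wkSub (drop idOPE) idₛ)   ≡⟨ prj-wkSub o (drop idOPE) idₛ ⟩
  wkSub (drop idOPE) (prj o idₛ)   ≡⟨ cong (wkSub (drop idOPE)) (prj-idₛ o) ⟩
  wkSub (drop idOPE) (wkSub o idₛ) ≡⟨ wkSub-keep-drop o idₛ ⟨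
  wkSub (keep o) (wkSub (drop idOPE) idₛ) ∎)
  where open ≡-Reasoning
prj-idₛ (keep🔒 o) = cong (λ σ → lock σ (lock nil)) (prj-idₛ o)

-- Conversion

≈-setoid : Ctx → Ty → Setoid _ _
≈-setoid Γ A = record
  { Carrier       = Tm Γ A
  ; _≈_           = _≈_
  ; isEquivalence = record { refl = ≈-refl ; sym = ≈-sym ; trans = ≈-trans }
  }

module ≈-Reasoning {Γ A} = SetoidReasoning (≈-setoid Γ A)

≡⇒≈ : ∀ {Γ A} {t u : Tm Γ A} → t ≡ u → t ≈ u
≡⇒≈ refl = ≈-refl

≈-wk : ∀ {Γ' Γ A} {t u : Tm Γ A} (o : Γ' ≤ Γ) → t ≈ u → wk o t ≈ wk o u
≈-wk o ≈-refl                 = ≈-refl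
≈-wk o (≈-sym p)              = ≈-sym (≈-wk o p)
≈-wk o (≈-trans p q)          = ≈-trans (≈-wk o p) (≈-wk o q)
≈-wk o (cong-lam p)           = cong-lam (≈-wk (keep o) p)
≈-wk o (cong-app p q)         = cong-app (≈-wk o p) (≈-wk o q)
≈-wk o (cong-box p)           = cong-box (≈-wk (keep🔒 o) p)
≈-wk o (cong-unbox {e = e} p) = cong-unbox (≈-wk (factorWk o e) p)
≈-wk o (⇒-β t u) = begin
  app (lam (wk (keep o) t)) (wk o u)   ≈⟨ ⇒-β _ _ ⟩
  wk (keep o) t [ idₛ ,ₛ wk o u ]      ≡⟨ []-wk (keep o) t _ ⟩
  t [ prj o idₛ ,ₛ wk o u ]            ≡⟨ cong (λ σ → t [ σ ,ₛ wk o u ]) (prj-idₛ o) ⟩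
  t [ wkSub o (idₛ ,ₛ u) ]             ≡⟨ wk-[] o t _ ⟨
  wk o (t [ idₛ ,ₛ u ])                ∎
  where open ≈-Reasoning
≈-wk o (⇒-η t) = ≈-trans (⇒-η (wk o t)) (≡⇒≈ (cong (λ t' → lam (app t' (var zero))) (sym (wk-keep-drop o t))))
≈-wk o (□-β t e) = begin
  unbox (box (wk (keep🔒 W) t)) (factorExt o e)   ≈⟨ □-β _ _ ⟩
  wk (keep🔒 W) t [ lock idₛ (factorExt o e) ]    ≡⟨ []-wk (keep🔒 W) t _ ⟩
  t [ lock (prj W idₛ) (factorExt o e) ]          ≡⟨ cong (λ σ → t [ lock σ (factorExt o e) ]) (prj-idₛ W) ⟩
  t [ wkSub o (lock idₛ e) ]                      ≡⟨ wk-[] o t _ ⟨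
  wk o (t [ lock idₛ e ])                         ∎
  where
  open ≈-Reasoning
  W = factorWk o e
≈-wk o (□-η t) = □-η (wk o t)
≈-wk o (shift-unbox t e lf e') = begin
  unboxVia (factor o (e ∙ e')) t
    ≡⟨ cong (λ g → unboxVia g t) (factor-∙ o e e') ⟩
  unbox (wk (factorWk W e) t) (factorExt W e ∙ factorExt o e')
    ≈⟨ shift-unbox _ _ (factorExt-LockFree W lf) _ ⟩
  unbox (wk (toOPE (factorExt W e) (factorExt-LockFree W lf)) (wk (factorWk W e) t)) (factorExt o e')
    ≡⟨ cong (λ t' → unbox t' (factorExt o e')) (wk-● _ _ t) ⟨
  unbox (wk (toOPE (factorExt W e) (factorExt-LockFree W lf) ● factorWk W e) t) (factorExt o e')
    ≡⟨ cong (λ o' → unbox (wk o' t) (factorExt o e')) (toOPE-factor e lf W) ⟨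
  unbox (wk (W ● toOPE e lf) t) (factorExt o e')
    ≡⟨ cong (λ t' → unbox t' (factorExt o e')) (wk-● _ _ t) ⟩
  wk o (unbox (wk (toOPE e lf) t) e') ∎
  where
  open ≈-Reasoning
  W = factorWk o e'

-- Conversion of substitutions

-- The substitution counterpart of shift-unbox is what makes t [ idₛ ] ≈ t
-- hold: factorising idₛ through e only yields lock idₛ e up to shifting.
infix 4 _≈ₛ_
data _≈ₛ_ : ∀ {Γ Δ} → Sub Γ Δ → Sub Γ Δ → Set where
  ≈ₛ-refl  : ∀ {Γ Δ} {s : Sub Γ Δ} → s ≈ₛ s
  ≈ₛ-sym   : ∀ {Γ Δ} {s s' : Sub Γ Δ} → s ≈ₛ s' → s' ≈ₛ s
  ≈ₛ-trans : ∀ {Γ Δ} {s s' s'' : Sub Γ Δ} → s ≈ₛ s' → s' ≈ₛ s'' → s ≈ₛ s''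
  ≈ₛ-ext   : ∀ {Γ Δ A} {s s' : Sub Γ Δ} {t t' : Tm Γ A} → s ≈ₛ s' → t ≈ t' → (s ,ₛ t) ≈ₛ (s' ,ₛ t')
  ≈ₛ-lock  : ∀ {Γ Δ Θ} {s s' : Sub Θ Δ} {e : Θ ◁ Γ} → s ≈ₛ s' → lock s e ≈ₛ lock s' e
  ≈ₛ-shift : ∀ {Γ Θ' Θ Δ} (s : Sub Θ Δ) (e₁ : Θ ◁ Θ') (lf : LockFree e₁) (e : Θ' ◁ Γ) →
             lock s (e₁ ∙ e) ≈ₛ lock (wkSub (toOPE e₁ lf) s) e

≈ₛ-setoid : Ctx → Ctx → Setoid _ _
≈ₛ-setoid Γ Δ = record
  { Carrier       = Sub Γ Δ
  ; _≈_           = _≈ₛ_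
  ; isEquivalence = record { refl = ≈ₛ-refl ; sym = ≈ₛ-sym ; trans = ≈ₛ-trans }
  }

module ≈ₛ-Reasoning {Γ Δ} = SetoidReasoning (≈ₛ-setoid Γ Δ)

≡⇒≈ₛ : ∀ {Γ Δ} {s s' : Sub Γ Δ} → s ≡ s' → s ≈ₛ s'
≡⇒≈ₛ refl = ≈ₛ-refl

≈ₛ-wk : ∀ {Γ' Γ Δ} {s s' : Sub Γ Δ} (o : Γ' ≤ Γ) → s ≈ₛ s' → wkSub o s ≈ₛ wkSub o s'
≈ₛ-wk o ≈ₛ-refl              = ≈ₛ-refl
≈ₛ-wk o (≈ₛ-sym p)           = ≈ₛ-sym (≈ₛ-wk o p)
≈ₛ-wk o (≈ₛ-trans p q)       = ≈ₛ-trans (≈ₛ-wk o p) (≈ₛ-wk o q)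
≈ₛ-wk o (≈ₛ-ext p q)         = ≈ₛ-ext (≈ₛ-wk o p) (≈-wk o q)
≈ₛ-wk o (≈ₛ-lock {e = e} p)  = ≈ₛ-lock (≈ₛ-wk (factorWk o e) p)
≈ₛ-wk o (≈ₛ-shift s e₁ lf e) = begin
  lockVia (factor o (e₁ ∙ e)) s
    ≡⟨ cong (λ g → lockVia g s) (factor-∙ o e₁ e) ⟩
  lock (wkSub (factorWk W e₁) s) (factorExt W e₁ ∙ factorExt o e)
    ≈⟨ ≈ₛ-shift _ _ (factorExt-LockFree W lf) _ ⟩
  lock (wkSub (toOPE (factorExt W e₁) (factorExt-LockFree W lf)) (wkSub (factorWk W e₁) s)) (factorExt o e)
    ≡⟨ cong (λ σ → lock σ (factorExt o e)) (wkSub-● _ _ s) ⟨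
  lock (wkSub (toOPE (factorExt W e₁) (factorExt-LockFree W lf) ● factorWk W e₁) s) (factorExt o e)
    ≡⟨ cong (λ o' → lock (wkSub o' s) (factorExt o e)) (toOPE-factor e₁ lf W) ⟨
  lock (wkSub (W ● toOPE e₁ lf) s) (factorExt o e)
    ≡⟨ cong (λ σ → lock σ (factorExt o e)) (wkSub-● _ _ s) ⟩
  wkSub o (lock (wkSub (toOPE e₁ lf) s) e) ∎
  where
  open ≈ₛ-Reasoning
  W = factorWk o e

extendLock : ∀ {Γ Γ' Δ} → Sub Γ (Δ `,🔒) → Γ ◁ Γ' → Sub Γ' (Δ `,🔒)
extendLock (lock σ x) e = lock σ (x ∙ e)

extendLock-cong : ∀ {Γ Γ' Δ} {S S' : Sub Γ (Δ `,🔒)} (e : Γ ◁ Γ') →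
                  S ≈ₛ S' → extendLock S e ≈ₛ extendLock S' e
extendLock-cong e ≈ₛ-refl                = ≈ₛ-refl
extendLock-cong e (≈ₛ-sym p)             = ≈ₛ-sym (extendLock-cong e p)
extendLock-cong e (≈ₛ-trans p q)         = ≈ₛ-trans (extendLock-cong e p) (extendLock-cong e q)
extendLock-cong e (≈ₛ-lock p)            = ≈ₛ-lock p
extendLock-cong e (≈ₛ-shift s e₁ lf e₂) =
  ≈ₛ-trans (≡⇒≈ₛ (cong (lock s) (∙-assoc e₁ e₂ e))) (≈ₛ-shift s e₁ lf (e₂ ∙ e))

factorS-cong : ∀ {Γ Δ Δ₀} {s s' : Sub Γ Δ} → s ≈ₛ s' → (e : Δ₀ ◁ Δ) →
               lockSub (factorS e s) ≈ₛ lockSub (factorS e s')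
factorS-cong ≈ₛ-refl                 e        = ≈ₛ-refl
factorS-cong (≈ₛ-sym p)              e        = ≈ₛ-sym (factorS-cong p e)
factorS-cong (≈ₛ-trans p q)          e        = ≈ₛ-trans (factorS-cong p e) (factorS-cong q e)
factorS-cong p@(≈ₛ-ext _ _)          nil      = ≈ₛ-lock p
factorS-cong (≈ₛ-ext p q)            (ext e)  = factorS-cong p e
factorS-cong p@(≈ₛ-lock _)           nil      = ≈ₛ-lock p
factorS-cong (≈ₛ-lock {e = e₀} p)    (lock e) = extendLock-cong e₀ (factorS-cong p e)
factorS-cong p@(≈ₛ-shift _ _ _ _)    nil      = ≈ₛ-lock p
factorS-cong (≈ₛ-shift s e₁ lf e₀)   (lock e) with factor-toOPE e₁ lf (factorSExt e s)
... | k , lfk , commutes , k≡ = begin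
  lock σ (X ∙ (e₁ ∙ e₀))                        ≡⟨ cong (lock σ) (∙-assoc X e₁ e₀) ⟨
  lock σ ((X ∙ e₁) ∙ e₀)                        ≡⟨ cong (λ x → lock σ (x ∙ e₀)) commutes ⟩
  lock σ ((k ∙ factorExt o X) ∙ e₀)             ≡⟨ cong (lock σ) (∙-assoc k _ e₀) ⟩
  lock σ (k ∙ (factorExt o X ∙ e₀))             ≈⟨ ≈ₛ-shift σ k lfk _ ⟩
  lock (wkSub (toOPE k lfk) σ) (factorExt o X ∙ e₀)
    ≡⟨ cong (λ o' → lock (wkSub o' σ) (factorExt o X ∙ e₀)) k≡ ⟩
  lock (wkSub (factorWk o X) σ) (factorExt o X ∙ e₀)
    ≡⟨ cong (λ h → lockSub (h ◆∙ e₀)) (factorS-wkSub o e s) ⟨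
  lockSub (factorS e (wkSub o s) ◆∙ e₀)         ∎
  where
  open ≈ₛ-Reasoning
  o = toOPE e₁ lf
  σ = factorSub e s
  X = factorSExt e s

substVar-cong : ∀ {Γ Δ A} {s s' : Sub Γ Δ} (v : Var Δ A) → s ≈ₛ s' → substVar v s ≈ substVar v s'
substVar-cong v        ≈ₛ-refl        = ≈-refl
substVar-cong v        (≈ₛ-sym p)     = ≈-sym (substVar-cong v p)
substVar-cong v        (≈ₛ-trans p q) = ≈-trans (substVar-cong v p) (substVar-cong v q)
substVar-cong zero     (≈ₛ-ext p q)   = q
substVar-cong (succ v) (≈ₛ-ext p q)   = substVar-cong v p

unboxUnder : ∀ {Γ Δ A} → Tm Δ (□ A) → Sub Γ (Δ `,🔒) → Tm Γ A
unboxUnder t (lock σ x) = unbox (t [ σ ]) x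

-- Congruence of t [_] is a hypothesis so that []-cong stays structurally recursive.
unboxUnder-cong : ∀ {Γ Δ A} (t : Tm Δ (□ A)) →
                  (∀ {Γ'} {s s' : Sub Γ' Δ} → s ≈ₛ s' → t [ s ] ≈ t [ s' ]) →
                  {S S' : Sub Γ (Δ `,🔒)} → S ≈ₛ S' → unboxUnder t S ≈ unboxUnder t S'
unboxUnder-cong t []-cong-t ≈ₛ-refl              = ≈-refl
unboxUnder-cong t []-cong-t (≈ₛ-sym p)           = ≈-sym (unboxUnder-cong t []-cong-t p)
unboxUnder-cong t []-cong-t (≈ₛ-trans p q)       =
  ≈-trans (unboxUnder-cong t []-cong-t p) (unboxUnder-cong t []-cong-t q)
unboxUnder-cong t []-cong-t (≈ₛ-lock p)          = cong-unbox ([]-cong-t p)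
unboxUnder-cong t []-cong-t (≈ₛ-shift s e₁ lf e) =
  ≈-trans (shift-unbox (t [ s ]) e₁ lf e) (≡⇒≈ (cong (λ t' → unbox t' e) (wk-[] (toOPE e₁ lf) t s)))

[]-cong : ∀ {Γ Δ A} (t : Tm Δ A) {s s' : Sub Γ Δ} → s ≈ₛ s' → t [ s ] ≈ t [ s' ]
[]-cong (var v)     p = substVar-cong v p
[]-cong (lam t)     p = cong-lam ([]-cong t (≈ₛ-ext (≈ₛ-wk (drop idOPE) p) ≈-refl))
[]-cong (app t u)   p = cong-app ([]-cong t p) ([]-cong u p)
[]-cong (box t)     p = cong-box ([]-cong t (≈ₛ-lock p))
[]-cong (unbox t e) p = unboxUnder-cong t ([]-cong t) (factorS-cong p e)

substVar-idₛ : ∀ {Γ A} (v : Var Γ A) → substVar v idₛ ≡ var v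
substVar-idₛ zero     = refl
substVar-idₛ (succ v) = begin
  substVar v (wkSub (drop idOPE) idₛ)   ≡⟨ substVar-wkSub (drop idOPE) v idₛ ⟩
  wk (drop idOPE) (substVar v idₛ)      ≡⟨ cong (wk (drop idOPE)) (substVar-idₛ v) ⟩
  var (succ (wkVar idOPE v))            ≡⟨ cong (λ w → var (succ w)) (wkVar-id v) ⟩
  var (succ v)                          ∎
  where open ≡-Reasoning

lockVia-factor-id : ∀ {Γ Θ Δ} (e : Θ ◁ Γ) (s : Sub Θ Δ) → lockVia (factor idOPE e) s ≡ lock s e
lockVia-factor-id e s = trans (cong (λ g → lockVia g s) (factor-id e)) (cong (λ σ → lock σ e) (wkSub-id s))

lockVia-drop-idₛ : ∀ {Δ Γ A} (e : Δ ◁ Γ) → lockVia (factor (drop {A = A} idOPE) e) idₛ ≈ₛ lock idₛ (ext e)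
lockVia-drop-idₛ nil      = ≈ₛ-sym (≈ₛ-shift idₛ (ext nil) (ext nil) nil)
lockVia-drop-idₛ (ext e)  = ≡⇒≈ₛ (cong (λ S → extendLock S (ext nil)) (lockVia-factor-id (ext e) idₛ))
lockVia-drop-idₛ (lock e) = ≡⇒≈ₛ (cong (λ S → extendLock S (ext nil)) (lockVia-factor-id (lock e) idₛ))

factorS-idₛ : ∀ {Δ Γ} (e : Δ ◁ Γ) → lockSub (factorS e idₛ) ≈ₛ lock idₛ e
factorS-idₛ nil      = ≈ₛ-refl
factorS-idₛ (ext e)  = begin
  lockSub (factorS e (wkSub (drop idOPE) idₛ))   ≡⟨ cong lockSub (factorS-wkSub (drop idOPE) e idₛ) ⟩
  wkSub (drop idOPE) (lockSub (factorS e idₛ))   ≈⟨ ≈ₛ-wk (drop idOPE) (factorS-idₛ e) ⟩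
  wkSub (drop idOPE) (lock idₛ e)                ≈⟨ lockVia-drop-idₛ e ⟩
  lock idₛ (ext e)                               ∎
  where open ≈ₛ-Reasoning
factorS-idₛ (lock e) = extendLock-cong (lock nil) (factorS-idₛ e)

[]-idₛ : ∀ {Γ A} (t : Tm Γ A) → t [ idₛ ] ≈ t
[]-idₛ (var v)     = ≡⇒≈ (substVar-idₛ v)
[]-idₛ (lam t)     = cong-lam ([]-idₛ t)
[]-idₛ (app t u)   = cong-app ([]-idₛ t) ([]-idₛ u)
[]-idₛ (box t)     = cong-box ([]-idₛ t)
[]-idₛ (unbox t e) = ≈-trans (unboxUnder-cong t ([]-cong t) (factorS-idₛ e)) (cong-unbox ([]-idₛ t))

precompLock : ∀ {Γ Θ Δ} → Sub Θ Δ → Sub Γ (Θ `,🔒) → Sub Γ (Δ `,🔒)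
precompLock s (lock σ x) = lock (s ⊛ σ) x

⊛-congʳ         : ∀ {Γ Θ Δ} (s : Sub Θ Δ) {σ σ' : Sub Γ Θ} → σ ≈ₛ σ' → s ⊛ σ ≈ₛ s ⊛ σ'
precompLock-cong : ∀ {Γ Θ Δ} (s : Sub Θ Δ) {S S' : Sub Γ (Θ `,🔒)} →
                   S ≈ₛ S' → precompLock s S ≈ₛ precompLock s S'
⊛-congʳ empty      p = ≈ₛ-refl
⊛-congʳ (s ,ₛ t)   p = ≈ₛ-ext (⊛-congʳ s p) ([]-cong t p)
⊛-congʳ (lock s e) p = precompLock-cong s (factorS-cong p e)
precompLock-cong s ≈ₛ-refl              = ≈ₛ-refl
precompLock-cong s (≈ₛ-sym p)           = ≈ₛ-sym (precompLock-cong s p)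
precompLock-cong s (≈ₛ-trans p q)       = ≈ₛ-trans (precompLock-cong s p) (precompLock-cong s q)
precompLock-cong s (≈ₛ-lock p)          = ≈ₛ-lock (⊛-congʳ s p)
precompLock-cong s (≈ₛ-shift σ e₁ lf e) =
  ≈ₛ-trans (≈ₛ-shift (s ⊛ σ) e₁ lf e)
           (≡⇒≈ₛ (cong (λ σ' → lock σ' e) (sym (⊛-wkSub (toOPE e₁ lf) s σ))))

⊛-identityʳ : ∀ {Θ Δ} (s : Sub Θ Δ) → s ⊛ idₛ ≈ₛ s
⊛-identityʳ empty      = ≈ₛ-refl
⊛-identityʳ (s ,ₛ t)   = ≈ₛ-ext (⊛-identityʳ s) ([]-idₛ t)
⊛-identityʳ (lock s e) = ≈ₛ-trans (precompLock-cong s (factorS-idₛ e)) (≈ₛ-lock (⊛-identityʳ s))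

-- The model

⟦_⟧ : Ty → Ctx → Set
⟦ ι ⟧     Γ = Tm Γ ι
⟦ A ⇒ B ⟧ Γ = ∀ {Γ'} → Γ' ≤ Γ → ⟦ A ⟧ Γ' → ⟦ B ⟧ Γ'
⟦ □ A ⟧   Γ = ∀ {Γ' Δ} → Γ' ≤ Γ → Γ' ◁ Δ → ⟦ A ⟧ Δ

wkV : ∀ A {Γ' Γ} → Γ' ≤ Γ → ⟦ A ⟧ Γ → ⟦ A ⟧ Γ'
wkV ι       o t = wk o t
wkV (A ⇒ B) o f = λ o' → f (o' ● o)
wkV (□ A)   o f = λ o' e → f (o' ● o) e

reify   : ∀ A {Γ} → ⟦ A ⟧ Γ → Tm Γ A
reflect : ∀ A {Γ} → Tm Γ A → ⟦ A ⟧ Γ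
reify ι       t = t
reify (A ⇒ B) f = lam (reify B (f (drop idOPE) (reflect A (var zero))))
reify (□ A)   f = box (reify A (f idOPE (lock nil)))
reflect ι       t = t
reflect (A ⇒ B) t = λ o a → reflect B (app (wk o t) (reify A a))
reflect (□ A)   t = λ o e → reflect A (unbox (wk o t) e)

-- Semantic equality: a PER whose diagonal contains only values that are
-- uniform, i.e. natural in the OPE argument (the model has no funext).
infix 4 [_]_≋_
[_]_≋_    : ∀ A {Γ} → ⟦ A ⟧ Γ → ⟦ A ⟧ Γ → Set
Uniform⇒ : ∀ A B {Γ} → ⟦ A ⇒ B ⟧ Γ → Set
Uniform□ : ∀ A {Γ} → ⟦ □ A ⟧ Γ → Set
[ ι ] a ≋ b = a ≡ b
[ A ⇒ B ] f ≋ g =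
  (∀ {Γ'} (o : Γ' ≤ _) {a b} → [ A ] a ≋ b → [ B ] f o a ≋ g o b) × Uniform⇒ A B f × Uniform⇒ A B g
[ □ A ] f ≋ g =
  (∀ {Γ' Δ} (o : Γ' ≤ _) (e : Γ' ◁ Δ) → [ A ] f o e ≋ g o e) × Uniform□ A f × Uniform□ A g
Uniform⇒ A B {Γ} f = ∀ {Γ' Γ''} (o : Γ' ≤ Γ) (o' : Γ'' ≤ Γ') {a b} → [ A ] a ≋ b →
                     [ B ] wkV B o' (f o a) ≋ f (o' ● o) (wkV A o' b)
Uniform□ A {Γ} f = ∀ {Γ' Δ Δ'} (o : Γ' ≤ Γ) (e : Γ' ◁ Δ) (o' : Δ' ≤ Δ) →
                   [ A ] wkV A o' (f o e) ≋ f (factorWk o' e ● o) (factorExt o' e)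

≋-sym : ∀ A {Γ} {a b : ⟦ A ⟧ Γ} → [ A ] a ≋ b → [ A ] b ≋ a
≋-sym ι       p              = sym p
≋-sym (A ⇒ B) (p , uf , ug)  = (λ o q → ≋-sym B (p o (≋-sym A q))) , ug , uf
≋-sym (□ A)   (p , uf , ug)  = (λ o e → ≋-sym A (p o e)) , ug , uf

≋-trans : ∀ A {Γ} {a b c : ⟦ A ⟧ Γ} → [ A ] a ≋ b → [ A ] b ≋ c → [ A ] a ≋ c
≋-trans ι       p            q            = trans p q
≋-trans (A ⇒ B) (p , uf , _) (q , _ , uh) =
  (λ o r → ≋-trans B (p o r) (q o (≋-trans A (≋-sym A r) r))) , uf , uh
≋-trans (□ A)   (p , uf , _) (q , _ , uh) = (λ o e → ≋-trans A (p o e) (q o e)) , uf , uh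

≋-reflˡ : ∀ A {Γ} {a b : ⟦ A ⟧ Γ} → [ A ] a ≋ b → [ A ] a ≋ a
≋-reflˡ A p = ≋-trans A p (≋-sym A p)

≋-reflʳ : ∀ A {Γ} {a b : ⟦ A ⟧ Γ} → [ A ] a ≋ b → [ A ] b ≋ b
≋-reflʳ A p = ≋-trans A (≋-sym A p) p

uniform⇒ : ∀ {A B Γ} {f g : ⟦ A ⇒ B ⟧ Γ} → [ A ⇒ B ] f ≋ g → Uniform⇒ A B f
uniform⇒ = proj₁ ∘ proj₂

uniform□ : ∀ {A Γ} {f g : ⟦ □ A ⟧ Γ} → [ □ A ] f ≋ g → Uniform□ A f
uniform□ = proj₁ ∘ proj₂

wkV-≋ : ∀ A {Γ' Γ} (o : Γ' ≤ Γ) {a b : ⟦ A ⟧ Γ} → [ A ] a ≋ b → [ A ] wkV A o a ≋ wkV A o b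
wkV-≋ ι       o p = cong (wk o) p
wkV-≋ (A ⇒ B) {Γ = Γ} o {f} {g} (p , uf , ug) = (λ o' → p (o' ● o)) , wkV-uniform f uf , wkV-uniform g ug
  where
  wkV-uniform : (h : ⟦ A ⇒ B ⟧ Γ) → Uniform⇒ A B h → Uniform⇒ A B (wkV (A ⇒ B) o h)
  wkV-uniform h u o₁ o₂ {a} {b} q =
    subst (λ o' → [ B ] wkV B o₂ (h (o₁ ● o) a) ≋ h o' (wkV A o₂ b))
          (sym (●-assoc o₂ o₁ o)) (u (o₁ ● o) o₂ q)
wkV-≋ (□ A)   {Γ = Γ} o {f} {g} (p , uf , ug) = (λ o' → p (o' ● o)) , wkV-uniform f uf , wkV-uniform g ug
  where
  wkV-uniform : (h : ⟦ □ A ⟧ Γ) → Uniform□ A h → Uniform□ A (wkV (□ A) o h)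
  wkV-uniform h u o₁ e o₂ =
    subst (λ o' → [ A ] wkV A o₂ (h (o₁ ● o) e) ≋ h o' (factorExt o₂ e))
          (sym (●-assoc (factorWk o₂ e) o₁ o)) (u (o₁ ● o) e o₂)

wkV-id : ∀ A {Γ} {a : ⟦ A ⟧ Γ} → [ A ] a ≋ a → [ A ] wkV A idOPE a ≋ a
wkV-id ι       {a = a} p            = wk-id a
wkV-id (A ⇒ B) {a = f} p@(q , uf , _) =
  (λ o {a} {b} r → subst (λ o' → [ B ] f o' a ≋ f o b) (sym (●-identityʳ o)) (q o r)) ,
  uniform⇒ (wkV-≋ (A ⇒ B) idOPE p) , uf
wkV-id (□ A)   {a = f} p@(q , uf , _) =
  (λ o e → subst (λ o' → [ A ] f o' e ≋ f o e) (sym (●-identityʳ o)) (q o e)) ,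
  uniform□ (wkV-≋ (□ A) idOPE p) , uf

wkV-● : ∀ A {Γ'' Γ' Γ} (o' : Γ'' ≤ Γ') (o : Γ' ≤ Γ) {a : ⟦ A ⟧ Γ} → [ A ] a ≋ a →
        [ A ] wkV A o' (wkV A o a) ≋ wkV A (o' ● o) a
wkV-● ι       o' o {a} p              = sym (wk-● o' o a)
wkV-● (A ⇒ B) o' o {f} p@(q , _ , _) =
  (λ o₁ {a} {b} r → subst (λ o₂ → [ B ] f o₂ a ≋ f (o₁ ● (o' ● o)) b)
                          (sym (●-assoc o₁ o' o)) (q (o₁ ● (o' ● o)) r)) ,
  uniform⇒ (wkV-≋ (A ⇒ B) o' (wkV-≋ (A ⇒ B) o p)) , uniform⇒ (wkV-≋ (A ⇒ B) (o' ● o) p)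
wkV-● (□ A)   o' o {f} p@(q , _ , _) =
  (λ o₁ e → subst (λ o₂ → [ A ] f o₂ e ≋ f (o₁ ● (o' ● o)) e)
                  (sym (●-assoc o₁ o' o)) (q (o₁ ● (o' ● o)) e)) ,
  uniform□ (wkV-≋ (□ A) o' (wkV-≋ (□ A) o p)) , uniform□ (wkV-≋ (□ A) (o' ● o) p)

reify-≋    : ∀ A {Γ} {a b : ⟦ A ⟧ Γ} → [ A ] a ≋ b → reify A a ≡ reify A b
reflect-≋  : ∀ A {Γ} (t : Tm Γ A) → [ A ] reflect A t ≋ reflect A t
reify-wk   : ∀ A {Γ' Γ} (o : Γ' ≤ Γ) {a : ⟦ A ⟧ Γ} → [ A ] a ≋ a → reify A (wkV A o a) ≡ wk o (reify A a)
reflect-wk : ∀ A {Γ' Γ} (o : Γ' ≤ Γ) (t : Tm Γ A) → [ A ] wkV A o (reflect A t) ≋ reflect A (wk o t)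

reify-≋ ι       p           = p
reify-≋ (A ⇒ B) (p , _ , _) = cong lam (reify-≋ B (p (drop idOPE) (reflect-≋ A (var zero))))
reify-≋ (□ A)   (p , _ , _) = cong box (reify-≋ A (p idOPE (lock nil)))

reflect-≋ ι       t = refl
reflect-≋ (A ⇒ B) t = pointwise , uniform , uniform
  where
  pointwise : ∀ {Γ'} (o : Γ' ≤ _) {a b} → [ A ] a ≋ b →
              [ B ] reflect B (app (wk o t) (reify A a)) ≋ reflect B (app (wk o t) (reify A b))
  pointwise o {a} q = subst (λ u → [ B ] reflect B (app (wk o t) (reify A a)) ≋ reflect B (app (wk o t) u))
                            (reify-≋ A q) (reflect-≋ B _)
  uniform : Uniform⇒ A B (reflect (A ⇒ B) t)
  uniform o o' {a} {b} q =
    subst (λ u → [ B ] wkV B o' (reflect B (app (wk o t) (reify A a))) ≋ reflect B u)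
          (cong₂ app (sym (wk-● o' o t)) (trans (sym (reify-wk A o' (≋-reflˡ A q))) (reify-≋ A (wkV-≋ A o' q))))
          (reflect-wk B o' (app (wk o t) (reify A a)))
reflect-≋ (□ A)   t = (λ o e → reflect-≋ A _) , uniform , uniform
  where
  uniform : Uniform□ A (reflect (□ A) t)
  uniform o e o' =
    subst (λ t' → [ A ] wkV A o' (reflect A (unbox (wk o t) e)) ≋ reflect A (unbox t' (factorExt o' e)))
          (sym (wk-● (factorWk o' e) o t)) (reflect-wk A o' (unbox (wk o t) e))

reify-wk ι       o p                = refl
reify-wk (A ⇒ B) o {f} (p , uf , _) = cong lam (begin
  reify B (f (drop idOPE ● o) x)            ≡⟨ cong (λ o' → reify B (f o' x)) (keep-●-drop o) ⟨
  reify B (f (keep o ● drop idOPE) x)       ≡⟨ reify-≋ B natural ⟨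
  reify B (wkV B (keep o) (f (drop idOPE) x)) ≡⟨ reify-wk B (keep o) (p (drop idOPE) (reflect-≋ A (var zero))) ⟩
  wk (keep o) (reify B (f (drop idOPE) x))  ∎)
  where
  open ≡-Reasoning
  x : ∀ {Δ} → ⟦ A ⟧ (Δ `, A)
  x = reflect A (var zero)
  natural : [ B ] wkV B (keep o) (f (drop idOPE) x) ≋ f (keep o ● drop idOPE) x
  natural = ≋-trans B (uf (drop idOPE) (keep o) (reflect-≋ A (var zero)))
                      (p (keep o ● drop idOPE) (reflect-wk A (keep o) (var zero)))
reify-wk (□ A)   o {f} (p , uf , _) = cong box (begin
  reify A (f (idOPE ● o) (lock nil))               ≡⟨ cong (λ o' → reify A (f o' (lock nil))) (●-identity-comm o) ⟨
  reify A (f (o ● idOPE) (lock nil))               ≡⟨ reify-≋ A (uf idOPE (lock nil) (keep🔒 o)) ⟨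
  reify A (wkV A (keep🔒 o) (f idOPE (lock nil)))   ≡⟨ reify-wk A (keep🔒 o) (p idOPE (lock nil)) ⟩
  wk (keep🔒 o) (reify A (f idOPE (lock nil)))      ∎)
  where open ≡-Reasoning

reflect-wk ι       o t = refl
reflect-wk (A ⇒ B) o t =
  (λ o' {a} {b} q → subst (λ u → [ B ] reflect B (app (wk (o' ● o) t) (reify A a)) ≋ reflect B u)
                          (cong₂ app (wk-● o' o t) (reify-≋ A q)) (reflect-≋ B _)) ,
  uniform⇒ (wkV-≋ (A ⇒ B) o (reflect-≋ (A ⇒ B) t)) , uniform⇒ (reflect-≋ (A ⇒ B) (wk o t))
reflect-wk (□ A)   o t =
  (λ o' e → subst (λ t' → [ A ] reflect A (unbox (wk (o' ● o) t) e) ≋ reflect A (unbox t' e))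
                  (wk-● o' o t) (reflect-≋ A (unbox (wk (o' ● o) t) e))) ,
  uniform□ (wkV-≋ (□ A) o (reflect-≋ (□ A) t)) , uniform□ (reflect-≋ (□ A) (wk o t))

-- Evaluation

data Env : Ctx → Ctx → Set where
  []ₑ   : ∀ {W} → Env W ·
  _∷ₑ_  : ∀ {W Γ A} → Env W Γ → ⟦ A ⟧ W → Env W (Γ `, A)
  lockₑ : ∀ {W W' Γ} → Env W' Γ → W' ◁ W → Env W (Γ `,🔒)

wkE : ∀ {W' W Γ} → W' ≤ W → Env W Γ → Env W' Γ
wkE o []ₑ                    = []ₑ
wkE o (_∷ₑ_ {A = A} ρ a)     = wkE o ρ ∷ₑ wkV A o a
wkE o (lockₑ ρ e)            = lockₑ (wkE (factorWk o e) ρ) (factorExt o e)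

lookup : ∀ {W Γ A} → Var Γ A → Env W Γ → ⟦ A ⟧ W
lookup zero     (ρ ∷ₑ a) = a
lookup (succ v) (ρ ∷ₑ a) = lookup v ρ

factorEnv : ∀ {W Γ Δ} → Δ ◁ Γ → Env W Γ → ◆ (flip Env Δ) W
factorEnv nil      ρ            = ρ ,◁ nil
factorEnv (ext e)  (ρ ∷ₑ a)     = factorEnv e ρ
factorEnv (lock e) (lockₑ ρ e') = factorEnv e ρ ◆∙ e'

eval : ∀ {W Γ A} → Tm Γ A → Env W Γ → ⟦ A ⟧ W
eval (var v)     ρ = lookup v ρ
eval (lam t)     ρ = λ o a → eval t (wkE o ρ ∷ₑ a)
eval (app t u)   ρ = eval t ρ idOPE (eval u ρ)
eval (box t)     ρ = λ o e → eval t (lockₑ (wkE o ρ) e)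
eval (unbox t e) ρ = eval t (val (factorEnv e ρ)) idOPE (acc (factorEnv e ρ))

infix 4 _≋ₑ_
data _≋ₑ_ : ∀ {W Γ} → Env W Γ → Env W Γ → Set where
  []≋   : ∀ {W} → []ₑ {W} ≋ₑ []ₑ
  _∷≋_  : ∀ {W Γ A} {ρ ρ' : Env W Γ} {a b : ⟦ A ⟧ W} → ρ ≋ₑ ρ' → [ A ] a ≋ b → (ρ ∷ₑ a) ≋ₑ (ρ' ∷ₑ b)
  lock≋ : ∀ {W W' Γ} {ρ ρ' : Env W' Γ} {e : W' ◁ W} → ρ ≋ₑ ρ' → lockₑ ρ e ≋ₑ lockₑ ρ' e

≋ₑ-sym : ∀ {W Γ} {ρ ρ' : Env W Γ} → ρ ≋ₑ ρ' → ρ' ≋ₑ ρ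
≋ₑ-sym []≋                  = []≋
≋ₑ-sym (_∷≋_ {A = A} p q)   = ≋ₑ-sym p ∷≋ ≋-sym A q
≋ₑ-sym (lock≋ p)            = lock≋ (≋ₑ-sym p)

≋ₑ-trans : ∀ {W Γ} {ρ ρ' ρ'' : Env W Γ} → ρ ≋ₑ ρ' → ρ' ≋ₑ ρ'' → ρ ≋ₑ ρ''
≋ₑ-trans []≋                 []≋         = []≋
≋ₑ-trans (_∷≋_ {A = A} p q)  (p' ∷≋ q')  = ≋ₑ-trans p p' ∷≋ ≋-trans A q q'
≋ₑ-trans (lock≋ p)           (lock≋ p')  = lock≋ (≋ₑ-trans p p')

≋ₑ-reflˡ : ∀ {W Γ} {ρ ρ' : Env W Γ} → ρ ≋ₑ ρ' → ρ ≋ₑ ρ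
≋ₑ-reflˡ p = ≋ₑ-trans p (≋ₑ-sym p)

≋ₑ-reflʳ : ∀ {W Γ} {ρ ρ' : Env W Γ} → ρ ≋ₑ ρ' → ρ' ≋ₑ ρ'
≋ₑ-reflʳ p = ≋ₑ-trans (≋ₑ-sym p) p

wkE-≋ₑ : ∀ {W' W Γ} (o : W' ≤ W) {ρ ρ' : Env W Γ} → ρ ≋ₑ ρ' → wkE o ρ ≋ₑ wkE o ρ'
wkE-≋ₑ o []≋                 = []≋
wkE-≋ₑ o (_∷≋_ {A = A} p q)  = wkE-≋ₑ o p ∷≋ wkV-≋ A o q
wkE-≋ₑ o (lock≋ {e = e} p)   = lock≋ (wkE-≋ₑ (factorWk o e) p)

lockEnvVia : ∀ {W W' Γ} → ◆ (_≤ W') W → Env W' Γ → Env W (Γ `,🔒)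
lockEnvVia g ρ = lockₑ (wkE (val g) ρ) (acc g)

wkE-id : ∀ {W Γ} {ρ : Env W Γ} → ρ ≋ₑ ρ → wkE idOPE ρ ≋ₑ ρ
wkE-id []≋                              = []≋
wkE-id (_∷≋_ {A = A} p q)               = wkE-id p ∷≋ wkV-id A q
wkE-id {ρ = lockₑ ρ e} (lock≋ p) =
  subst (λ g → lockEnvVia g ρ ≋ₑ lockₑ ρ e) (sym (factor-id e)) (lock≋ (wkE-id p))

wkE-● : ∀ {W'' W' W Γ} (o' : W'' ≤ W') (o : W' ≤ W) {ρ : Env W Γ} → ρ ≋ₑ ρ →
        wkE o' (wkE o ρ) ≋ₑ wkE (o' ● o) ρ
wkE-● o' o []≋                        = []≋
wkE-● o' o (_∷≋_ {A = A} p q)         = wkE-● o' o p ∷≋ wkV-● A o' o q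
wkE-● o' o {lockₑ ρ e} (lock≋ p) =
  subst (λ g → wkE o' (wkE o (lockₑ ρ e)) ≋ₑ lockEnvVia g ρ) (sym (factor-● o' o e))
        (lock≋ (wkE-● (factorWk o' (factorExt o e)) (factorWk o e) p))

lookup-≋ₑ : ∀ {W Γ A} (v : Var Γ A) {ρ ρ' : Env W Γ} → ρ ≋ₑ ρ' → [ A ] lookup v ρ ≋ lookup v ρ'
lookup-≋ₑ zero     (p ∷≋ q) = q
lookup-≋ₑ (succ v) (p ∷≋ q) = lookup-≋ₑ v p

lookup-wkE : ∀ {W' W Γ A} (o : W' ≤ W) (v : Var Γ A) (ρ : Env W Γ) → lookup v (wkE o ρ) ≡ wkV A o (lookup v ρ)
lookup-wkE o zero     (ρ ∷ₑ a) = refl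
lookup-wkE o (succ v) (ρ ∷ₑ a) = lookup-wkE o v ρ

data ◆-Rel {P Q : Ctx → Set} (R : ∀ {Δ} → P Δ → Q Δ → Set) {Γ : Ctx} : ◆ P Γ → ◆ Q Γ → Set where
  ◆-rel : ∀ {Δ} {p : P Δ} {q : Q Δ} {x : Δ ◁ Γ} → R p q → ◆-Rel R (p ,◁ x) (q ,◁ x)

◆-Rel-∙ : ∀ {P Q} {R : ∀ {Δ} → P Δ → Q Δ → Set} {Γ Γ'} {g : ◆ P Γ} {h : ◆ Q Γ} (e : Γ ◁ Γ') →
          ◆-Rel R g h → ◆-Rel R (g ◆∙ e) (h ◆∙ e)
◆-Rel-∙ e (◆-rel r) = ◆-rel r

factorEnv-≋ₑ : ∀ {W Γ Δ} {ρ ρ' : Env W Γ} → ρ ≋ₑ ρ' → (e : Δ ◁ Γ) →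
               ◆-Rel _≋ₑ_ (factorEnv e ρ) (factorEnv e ρ')
factorEnv-≋ₑ p                   nil      = ◆-rel p
factorEnv-≋ₑ (p ∷≋ q)            (ext e)  = factorEnv-≋ₑ p e
factorEnv-≋ₑ (lock≋ {e = e'} p)  (lock e) = ◆-Rel-∙ e' (factorEnv-≋ₑ p e)

factorEnv-wkE : ∀ {W' W Γ Δ} (o : W' ≤ W) (e : Δ ◁ Γ) (ρ : Env W Γ) →
                factorEnv e (wkE o ρ) ≡ ◆-map (λ w → wkE w (val (factorEnv e ρ))) (factor o (acc (factorEnv e ρ)))
factorEnv-wkE o nil      ρ            = refl
factorEnv-wkE o (ext e)  (ρ ∷ₑ a)     = factorEnv-wkE o e ρ
factorEnv-wkE o (lock e) (lockₑ ρ e') =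
  trans (cong (_◆∙ factorExt o e') (factorEnv-wkE (factorWk o e') e ρ))
        (cong (◆-map (λ w → wkE w (val (factorEnv e ρ)))) (sym (factor-∙ o (acc (factorEnv e ρ)) e')))

prjEnv : ∀ {W Γ' Γ} → Γ' ≤ Γ → Env W Γ' → Env W Γ
prjEnv base      []ₑ         = []ₑ
prjEnv (drop o)  (ρ ∷ₑ a)    = prjEnv o ρ
prjEnv (keep o)  (ρ ∷ₑ a)    = prjEnv o ρ ∷ₑ a
prjEnv (keep🔒 o) (lockₑ ρ e) = lockₑ (prjEnv o ρ) e

prjEnv-id : ∀ {W Γ} (ρ : Env W Γ) → prjEnv idOPE ρ ≡ ρ
prjEnv-id []ₑ         = refl
prjEnv-id (ρ ∷ₑ a)    = cong (_∷ₑ a) (prjEnv-id ρ)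
prjEnv-id (lockₑ ρ e) = cong (λ ρ' → lockₑ ρ' e) (prjEnv-id ρ)

prjEnv-wkE : ∀ {W' W Γ' Γ} (o : Γ' ≤ Γ) (o' : W' ≤ W) (ρ : Env W Γ') →
             prjEnv o (wkE o' ρ) ≡ wkE o' (prjEnv o ρ)
prjEnv-wkE base             o' []ₑ         = refl
prjEnv-wkE (drop o)         o' (ρ ∷ₑ a)    = prjEnv-wkE o o' ρ
prjEnv-wkE (keep {A = A} o) o' (ρ ∷ₑ a)    = cong (_∷ₑ wkV A o' a) (prjEnv-wkE o o' ρ)
prjEnv-wkE (keep🔒 o)        o' (lockₑ ρ e) =
  cong (λ ρ' → lockₑ ρ' (factorExt o' e)) (prjEnv-wkE o (factorWk o' e) ρ)

prjEnv-≋ₑ : ∀ {W Γ' Γ} (o : Γ' ≤ Γ) {ρ ρ' : Env W Γ'} → ρ ≋ₑ ρ' → prjEnv o ρ ≋ₑ prjEnv o ρ'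
prjEnv-≋ₑ base      []≋       = []≋
prjEnv-≋ₑ (drop o)  (p ∷≋ q)  = prjEnv-≋ₑ o p
prjEnv-≋ₑ (keep o)  (p ∷≋ q)  = prjEnv-≋ₑ o p ∷≋ q
prjEnv-≋ₑ (keep🔒 o) (lock≋ p) = lock≋ (prjEnv-≋ₑ o p)

lookup-wkVar : ∀ {W Γ' Γ A} (o : Γ' ≤ Γ) (v : Var Γ A) (ρ : Env W Γ') →
               lookup (wkVar o v) ρ ≡ lookup v (prjEnv o ρ)
lookup-wkVar (drop o) v        (ρ ∷ₑ a) = lookup-wkVar o v ρ
lookup-wkVar (keep o) zero     (ρ ∷ₑ a) = refl
lookup-wkVar (keep o) (succ v) (ρ ∷ₑ a) = lookup-wkVar o v ρ

factorEnv-prjEnv : ∀ {W Γ' Γ Δ} (o : Γ' ≤ Γ) (e : Δ ◁ Γ) (ρ : Env W Γ') →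
                   factorEnv e (prjEnv o ρ) ≡ ◆-map (prjEnv (factorWk o e)) (factorEnv (factorExt o e) ρ)
factorEnv-prjEnv o         nil      ρ            = refl
factorEnv-prjEnv (drop o)  (ext e)  (ρ ∷ₑ a)     = factorEnv-prjEnv o (ext e) ρ
factorEnv-prjEnv (keep o)  (ext e)  (ρ ∷ₑ a)     = factorEnv-prjEnv o e ρ
factorEnv-prjEnv (drop o)  (lock e) (ρ ∷ₑ a)     = factorEnv-prjEnv o (lock e) ρ
factorEnv-prjEnv (keep🔒 o) (lock e) (lockₑ ρ e') = cong (_◆∙ e') (factorEnv-prjEnv o e ρ)

factorEnv-∙ : ∀ {W Γ Θ Δ} (e₁ : Δ ◁ Θ) (e₂ : Θ ◁ Γ) (ρ : Env W Γ) →
              factorEnv (e₁ ∙ e₂) ρ ≡ factorEnv e₁ (val (factorEnv e₂ ρ)) ◆∙ acc (factorEnv e₂ ρ)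
factorEnv-∙ e₁ nil       ρ            = refl
factorEnv-∙ e₁ (ext e₂)  (ρ ∷ₑ a)     = factorEnv-∙ e₁ e₂ ρ
factorEnv-∙ e₁ (lock e₂) (lockₑ ρ e') =
  trans (cong (_◆∙ e') (factorEnv-∙ e₁ e₂ ρ))
        (cong (val (factorEnv e₁ (val (factorEnv e₂ ρ))) ,◁_) (∙-assoc _ _ e'))

factorEnv-LockFree : ∀ {W Γ Δ} (e : Δ ◁ Γ) (lf : LockFree e) (ρ : Env W Γ) →
                     factorEnv e ρ ≡ (prjEnv (toOPE e lf) ρ ,◁ nil)
factorEnv-LockFree nil     nil      ρ        = cong (_,◁ nil) (sym (prjEnv-id ρ))
factorEnv-LockFree (ext e) (ext lf) (ρ ∷ₑ a) = factorEnv-LockFree e lf ρ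

eval-≋           : ∀ {Γ A W} (t : Tm Γ A) {ρ ρ' : Env W Γ} → ρ ≋ₑ ρ' → [ A ] eval t ρ ≋ eval t ρ'
eval-wkE         : ∀ {Γ A W W'} (t : Tm Γ A) (o : W' ≤ W) {ρ ρ' : Env W Γ} → ρ ≋ₑ ρ' →
                   [ A ] wkV A o (eval t ρ) ≋ eval t (wkE o ρ')
eval-lam-uniform : ∀ {Γ A B W} (t : Tm (Γ `, A) B) {ρ : Env W Γ} → ρ ≋ₑ ρ → Uniform⇒ A B (eval (lam t) ρ)
eval-box-uniform : ∀ {Γ A W} (t : Tm (Γ `,🔒) A) {ρ : Env W Γ} → ρ ≋ₑ ρ → Uniform□ A (eval (box t) ρ)

eval-lam-uniform {A = A} t p o o' q =
  ≋-trans _ (eval-wkE t o' (wkE-≋ₑ o p ∷≋ q)) (eval-≋ t (wkE-● o' o p ∷≋ wkV-≋ A o' (≋-reflʳ A q)))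

eval-box-uniform t p o e o' =
  ≋-trans _ (eval-wkE t o' (lock≋ (wkE-≋ₑ o p))) (eval-≋ t (lock≋ (wkE-● (factorWk o' e) o p)))

eval-≋ (var v)     p = lookup-≋ₑ v p
eval-≋ (lam t)     p = (λ o q → eval-≋ t (wkE-≋ₑ o p ∷≋ q)) ,
                       eval-lam-uniform t (≋ₑ-reflˡ p) , eval-lam-uniform t (≋ₑ-reflʳ p)
eval-≋ (app t u)   p = proj₁ (eval-≋ t p) idOPE (eval-≋ u p)
eval-≋ (box t)     p = (λ o e → eval-≋ t (lock≋ (wkE-≋ₑ o p))) ,
                       eval-box-uniform t (≋ₑ-reflˡ p) , eval-box-uniform t (≋ₑ-reflʳ p)
eval-≋ {A = A} (unbox t e) p = unbox-≋ (factorEnv-≋ₑ p e)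
  where
  unbox-≋ : ∀ {g g'} → ◆-Rel _≋ₑ_ g g' → [ A ] eval t (val g) idOPE (acc g) ≋ eval t (val g') idOPE (acc g')
  unbox-≋ (◆-rel {x = x} r) = proj₁ (eval-≋ t r) idOPE x

eval-wkE {A = A} (var v) o {ρ} {ρ'} p =
  subst ([ A ] wkV A o (lookup v ρ) ≋_) (sym (lookup-wkE o v ρ')) (wkV-≋ A o (lookup-≋ₑ v p))
eval-wkE {A = A ⇒ B} (lam t) o p =
  (λ o' q → eval-≋ t (≋ₑ-trans (wkE-≋ₑ (o' ● o) p) (≋ₑ-sym (wkE-● o' o (≋ₑ-reflʳ p))) ∷≋ q)) ,
  uniform⇒ (wkV-≋ (A ⇒ B) o (eval-≋ (lam t) (≋ₑ-reflˡ p))) ,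
  eval-lam-uniform t (wkE-≋ₑ o (≋ₑ-reflʳ p))
eval-wkE {A = B} (app {A = A} t u) o {ρ} p =
  ≋-trans B (subst (λ o' → [ B ] wkV B o (f idOPE a) ≋ f o' (wkV A o a)) (●-identity-comm o) natural)
            (proj₁ (eval-wkE t o p) idOPE (eval-wkE u o p))
  where
  f = eval t ρ
  a = eval u ρ
  natural : [ B ] wkV B o (f idOPE a) ≋ f (o ● idOPE) (wkV A o a)
  natural = uniform⇒ (eval-≋ t (≋ₑ-reflˡ p)) idOPE o (eval-≋ u (≋ₑ-reflˡ p))
eval-wkE {A = □ A} (box t) o p =
  (λ o' e → eval-≋ t (lock≋ (≋ₑ-trans (wkE-≋ₑ (o' ● o) p) (≋ₑ-sym (wkE-● o' o (≋ₑ-reflʳ p)))))) ,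
  uniform□ (wkV-≋ (□ A) o (eval-≋ (box t) (≋ₑ-reflˡ p))) ,
  eval-box-uniform t (wkE-≋ₑ o (≋ₑ-reflʳ p))
eval-wkE {A = A} (unbox t e) o {ρ} {ρ'} p =
  subst (λ g → [ A ] wkV A o (eval (unbox t e) ρ) ≋ eval t (val g) idOPE (acc g))
        (sym (factorEnv-wkE o e ρ')) (unbox-wk (factorEnv-≋ₑ p e))
  where
  unbox-wk : ∀ {g g'} → ◆-Rel _≋ₑ_ g g' →
             [ A ] wkV A o (eval t (val g) idOPE (acc g))
                 ≋ eval t (wkE (factorWk o (acc g')) (val g')) idOPE (factorExt o (acc g'))
  unbox-wk (◆-rel {p = σ} {x = x} r) =
    ≋-trans A (subst (λ o' → [ A ] wkV A o (eval t σ idOPE x) ≋ eval t σ o' (factorExt o x))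
                     (●-identity-comm (factorWk o x)) (uniform□ (eval-≋ t (≋ₑ-reflˡ r)) idOPE x o))
              (proj₁ (eval-wkE t (factorWk o x) r) idOPE (factorExt o x))

eval-wk : ∀ {Γ' Γ A W} (o : Γ' ≤ Γ) (t : Tm Γ A) {ρ ρ' : Env W Γ'} → ρ ≋ₑ ρ' →
          [ A ] eval (wk o t) ρ ≋ eval t (prjEnv o ρ')
eval-wk {A = A} o (var v) {ρ} {ρ'} p =
  subst ([ A ] lookup (wkVar o v) ρ ≋_) (lookup-wkVar o v ρ') (lookup-≋ₑ (wkVar o v) p)
eval-wk {A = A ⇒ B} o (lam t) {ρ} {ρ'} p =
  (λ o' {a} {b} q → subst (λ σ → [ B ] eval (wk (keep o) t) (wkE o' ρ ∷ₑ a) ≋ eval t (σ ∷ₑ b))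
                          (prjEnv-wkE o o' ρ') (eval-wk (keep o) t (wkE-≋ₑ o' p ∷≋ q))) ,
  eval-lam-uniform (wk (keep o) t) (≋ₑ-reflˡ p) , eval-lam-uniform t (prjEnv-≋ₑ o (≋ₑ-reflʳ p))
eval-wk o (app t u) p = proj₁ (eval-wk o t p) idOPE (eval-wk o u p)
eval-wk {A = □ A} o (box t) {ρ} {ρ'} p =
  (λ o' e → subst (λ σ → [ A ] eval (wk (keep🔒 o) t) (lockₑ (wkE o' ρ) e) ≋ eval t (lockₑ σ e))
                  (prjEnv-wkE o o' ρ') (eval-wk (keep🔒 o) t (lock≋ (wkE-≋ₑ o' p)))) ,
  eval-box-uniform (wk (keep🔒 o) t) (≋ₑ-reflˡ p) , eval-box-uniform t (prjEnv-≋ₑ o (≋ₑ-reflʳ p))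
eval-wk {A = A} o (unbox t e) {ρ} {ρ'} p =
  subst (λ g → [ A ] eval (wk o (unbox t e)) ρ ≋ eval t (val g) idOPE (acc g))
        (sym (factorEnv-prjEnv o e ρ')) (unbox-wk (factorEnv-≋ₑ p (factorExt o e)))
  where
  W = factorWk o e
  unbox-wk : ∀ {g g'} → ◆-Rel _≋ₑ_ g g' →
             [ A ] eval (wk W t) (val g) idOPE (acc g) ≋ eval t (prjEnv W (val g')) idOPE (acc g')
  unbox-wk (◆-rel {x = x} r) = proj₁ (eval-wk W t r) idOPE x

evalSub : ∀ {W Γ Δ} → Sub Γ Δ → Env W Γ → Env W Δ
evalSub empty      ρ = []ₑ
evalSub (s ,ₛ t)   ρ = evalSub s ρ ∷ₑ eval t ρ
evalSub (lock s e) ρ = lockₑ (evalSub s (val (factorEnv e ρ))) (acc (factorEnv e ρ))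

evalSub-≋ₑ : ∀ {W Γ Δ} (s : Sub Γ Δ) {ρ ρ' : Env W Γ} → ρ ≋ₑ ρ' → evalSub s ρ ≋ₑ evalSub s ρ'
evalSub-≋ₑ empty      p = []≋
evalSub-≋ₑ (s ,ₛ t)   p = evalSub-≋ₑ s p ∷≋ eval-≋ t p
evalSub-≋ₑ (lock s e) p = lock-≋ₑ (factorEnv-≋ₑ p e)
  where
  lock-≋ₑ : ∀ {g g'} → ◆-Rel _≋ₑ_ g g' →
            lockₑ (evalSub s (val g)) (acc g) ≋ₑ lockₑ (evalSub s (val g')) (acc g')
  lock-≋ₑ (◆-rel r) = lock≋ (evalSub-≋ₑ s r)

evalSub-wkE : ∀ {W' W Γ Δ} (s : Sub Γ Δ) (o : W' ≤ W) {ρ ρ' : Env W Γ} → ρ ≋ₑ ρ' →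
              wkE o (evalSub s ρ) ≋ₑ evalSub s (wkE o ρ')
evalSub-wkE empty      o p = []≋
evalSub-wkE (s ,ₛ t)   o p = evalSub-wkE s o p ∷≋ eval-wkE t o p
evalSub-wkE (lock s e) o {ρ} {ρ'} p =
  subst (λ g → wkE o (evalSub (lock s e) ρ) ≋ₑ lockₑ (evalSub s (val g)) (acc g))
        (sym (factorEnv-wkE o e ρ')) (lock-wk (factorEnv-≋ₑ p e))
  where
  lock-wk : ∀ {g g'} → ◆-Rel _≋ₑ_ g g' →
            wkE o (lockₑ (evalSub s (val g)) (acc g))
              ≋ₑ lockₑ (evalSub s (wkE (factorWk o (acc g')) (val g'))) (factorExt o (acc g'))
  lock-wk (◆-rel {x = x} r) = lock≋ (evalSub-wkE s (factorWk o x) r)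

evalSub-wkSub : ∀ {W Γ' Γ Δ} (o : Γ' ≤ Γ) (s : Sub Γ Δ) {ρ ρ' : Env W Γ'} → ρ ≋ₑ ρ' →
                evalSub (wkSub o s) ρ ≋ₑ evalSub s (prjEnv o ρ')
evalSub-wkSub o empty      p = []≋
evalSub-wkSub o (s ,ₛ t)   p = evalSub-wkSub o s p ∷≋ eval-wk o t p
evalSub-wkSub o (lock s e) {ρ} {ρ'} p =
  subst (λ g → evalSub (wkSub o (lock s e)) ρ ≋ₑ lockₑ (evalSub s (val g)) (acc g))
        (sym (factorEnv-prjEnv o e ρ')) (lock-wk (factorEnv-≋ₑ p (factorExt o e)))
  where
  W = factorWk o e
  lock-wk : ∀ {g g'} → ◆-Rel _≋ₑ_ g g' →
            lockₑ (evalSub (wkSub W s) (val g)) (acc g) ≋ₑ lockₑ (evalSub s (prjEnv W (val g'))) (acc g')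
  lock-wk (◆-rel r) = lock≋ (evalSub-wkSub W s r)

factorEnv-evalSub : ∀ {W Γ Δ Δ₀} (e : Δ₀ ◁ Δ) (s : Sub Γ Δ) (ρ : Env W Γ) →
                    factorEnv e (evalSub s ρ) ≡ ◆-map (evalSub (factorSub e s)) (factorEnv (factorSExt e s) ρ)
factorEnv-evalSub nil      s           ρ = refl
factorEnv-evalSub (ext e)  (s ,ₛ t)    ρ = factorEnv-evalSub e s ρ
factorEnv-evalSub (lock e) (lock s e') ρ =
  trans (cong (_◆∙ acc (factorEnv e' ρ)) (factorEnv-evalSub e s (val (factorEnv e' ρ))))
        (cong (◆-map (evalSub (factorSub e s))) (sym (factorEnv-∙ (factorSExt e s) e' ρ)))

eval-substVar : ∀ {W Γ Δ A} (v : Var Δ A) (s : Sub Γ Δ) {ρ ρ' : Env W Γ} → ρ ≋ₑ ρ' →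
                [ A ] eval (substVar v s) ρ ≋ lookup v (evalSub s ρ')
eval-substVar zero     (s ,ₛ t) p = eval-≋ t p
eval-substVar (succ v) (s ,ₛ t) p = eval-substVar v s p

eval-[] : ∀ {W Γ Δ A} (t : Tm Δ A) (s : Sub Γ Δ) {ρ ρ' : Env W Γ} → ρ ≋ₑ ρ' →
          [ A ] eval (t [ s ]) ρ ≋ eval t (evalSub s ρ')
eval-[] (var v) s p = eval-substVar v s p
eval-[] {A = A ⇒ B} (lam t) s {ρ} {ρ'} p =
  (λ o q → ≋-trans B (eval-[] t _ (wkE-≋ₑ o p ∷≋ q)) (eval-≋ t (lifted o q ∷≋ ≋-reflʳ A q))) ,
  eval-lam-uniform (t [ wkSub (drop idOPE) s ,ₛ var zero ]) (≋ₑ-reflˡ p) ,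
  eval-lam-uniform t (evalSub-≋ₑ s (≋ₑ-reflʳ p))
  where
  lifted : ∀ {W'} (o : W' ≤ _) {a b} → [ A ] a ≋ b →
           evalSub (wkSub (drop idOPE) s) (wkE o ρ' ∷ₑ b) ≋ₑ wkE o (evalSub s ρ')
  lifted o {b = b} q = ≋ₑ-trans
    (subst (λ σ → evalSub (wkSub (drop idOPE) s) (wkE o ρ' ∷ₑ b) ≋ₑ evalSub s σ) (prjEnv-id (wkE o ρ'))
           (evalSub-wkSub (drop idOPE) s (wkE-≋ₑ o (≋ₑ-reflʳ p) ∷≋ ≋-reflʳ A q)))
    (≋ₑ-sym (evalSub-wkE s o (≋ₑ-reflʳ p)))
eval-[] (app t u) s p = proj₁ (eval-[] t s p) idOPE (eval-[] u s p)
eval-[] {A = □ A} (box t) s {ρ} {ρ'} p =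
  (λ o e → ≋-trans A (eval-[] t (lock s (lock nil)) (lock≋ (wkE-≋ₑ o p)))
                     (eval-≋ t (subst (λ x → lockₑ (evalSub s (wkE o ρ')) (nil ∙ e) ≋ₑ lockₑ (wkE o (evalSub s ρ')) x)
                                      (∙-identityˡ e) (lock≋ (≋ₑ-sym (evalSub-wkE s o (≋ₑ-reflʳ p))))))) ,
  eval-box-uniform (t [ lock s (lock nil) ]) (≋ₑ-reflˡ p) , eval-box-uniform t (evalSub-≋ₑ s (≋ₑ-reflʳ p))
eval-[] {A = A} (unbox t e) s {ρ} {ρ'} p =
  subst (λ g → [ A ] eval (unbox t e [ s ]) ρ ≋ eval t (val g) idOPE (acc g))
        (sym (factorEnv-evalSub e s ρ')) (unbox-[] (factorEnv-≋ₑ p (factorSExt e s)))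
  where
  σ = factorSub e s
  unbox-[] : ∀ {g g'} → ◆-Rel _≋ₑ_ g g' →
             [ A ] eval (t [ σ ]) (val g) idOPE (acc g) ≋ eval t (evalSub σ (val g')) idOPE (acc g')
  unbox-[] (◆-rel {x = x} r) = proj₁ (eval-[] t σ r) idOPE x

evalSub-idₛ : ∀ {W Γ} {ρ ρ' : Env W Γ} → ρ ≋ₑ ρ' → evalSub idₛ ρ ≋ₑ ρ'
evalSub-idₛ []≋ = []≋
evalSub-idₛ {ρ = σ ∷ₑ a} {σ' ∷ₑ b} (p ∷≋ q) =
  ≋ₑ-trans (subst (λ σ'' → evalSub (wkSub (drop idOPE) idₛ) (σ ∷ₑ a) ≋ₑ evalSub idₛ σ'') (prjEnv-id σ')
                  (evalSub-wkSub (drop idOPE) idₛ (p ∷≋ q)))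
           (evalSub-idₛ (≋ₑ-reflʳ p)) ∷≋ q
evalSub-idₛ {ρ = lockₑ σ e} {lockₑ σ' .e} (lock≋ p) =
  subst (λ x → lockₑ (evalSub idₛ σ) x ≋ₑ lockₑ σ' e) (sym (∙-identityˡ e)) (lock≋ (evalSub-idₛ p))

-- Completeness

eval-⇒-β : ∀ {W Γ A B} (t : Tm (Γ `, A) B) (u : Tm Γ A) {ρ ρ' : Env W Γ} → ρ ≋ₑ ρ' →
           [ B ] eval (app (lam t) u) ρ ≋ eval (t [ idₛ ,ₛ u ]) ρ'
eval-⇒-β {B = B} t u p =
  ≋-trans B (eval-≋ t (≋ₑ-trans (wkE-id (≋ₑ-reflˡ p)) (≋ₑ-sym (evalSub-idₛ (≋ₑ-reflˡ p))) ∷≋ eval-≋ u (≋ₑ-reflˡ p)))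
            (≋-sym B (eval-[] t (idₛ ,ₛ u) (≋ₑ-sym p)))

eval-⇒-η : ∀ {W Γ A B} (t : Tm Γ (A ⇒ B)) {ρ ρ' : Env W Γ} → ρ ≋ₑ ρ' →
           [ A ⇒ B ] eval t ρ ≋ eval (lam (app (wk (drop idOPE) t) (var zero))) ρ'
eval-⇒-η {A = A} {B} t {ρ} {ρ'} p =
  (λ o r → ≋-trans B (proj₁ (eval-≋ t p) o r) (η-expanded o r)) ,
  uniform⇒ (eval-≋ t (≋ₑ-reflˡ p)) , eval-lam-uniform (app (wk (drop idOPE) t) (var zero)) (≋ₑ-reflʳ p)
  where
  η-expanded : ∀ {W'} (o : W' ≤ _) {a b} → [ A ] a ≋ b →
               [ B ] eval t ρ' o b ≋ eval (wk (drop idOPE) t) (wkE o ρ' ∷ₑ b) idOPE b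
  η-expanded o {b = b} r =
    subst (λ o' → [ B ] eval t ρ' o' b ≋ eval (wk (drop idOPE) t) (wkE o ρ' ∷ₑ b) idOPE b) (●-identityˡ o)
          (≋-sym B (proj₁ weakened idOPE (≋-reflʳ A r)))
    where
    dropped : [ A ⇒ B ] eval (wk (drop idOPE) t) (wkE o ρ' ∷ₑ b) ≋ eval t (wkE o ρ')
    dropped = subst (λ σ → [ A ⇒ B ] eval (wk (drop idOPE) t) (wkE o ρ' ∷ₑ b) ≋ eval t σ) (prjEnv-id (wkE o ρ'))
                    (eval-wk (drop idOPE) t (wkE-≋ₑ o (≋ₑ-reflʳ p) ∷≋ ≋-reflʳ A r))
    weakened : [ A ⇒ B ] eval (wk (drop idOPE) t) (wkE o ρ' ∷ₑ b) ≋ wkV (A ⇒ B) o (eval t ρ')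
    weakened = ≋-trans (A ⇒ B) dropped (≋-sym (A ⇒ B) (eval-wkE t o (≋ₑ-reflʳ p)))

eval-□-β : ∀ {W Γ Δ A} (t : Tm (Δ `,🔒) A) (e : Δ ◁ Γ) {ρ ρ' : Env W Γ} → ρ ≋ₑ ρ' →
           [ A ] eval (unbox (box t) e) ρ ≋ eval (t [ lock idₛ e ]) ρ'
eval-□-β {A = A} t e p = ≋-trans A (unbox-box (factorEnv-≋ₑ p e)) (≋-sym A (eval-[] t (lock idₛ e) (≋ₑ-reflʳ p)))
  where
  unbox-box : ∀ {g g'} → ◆-Rel _≋ₑ_ g g' →
              [ A ] eval t (lockₑ (wkE idOPE (val g)) (acc g)) ≋ eval t (lockₑ (evalSub idₛ (val g')) (acc g'))
  unbox-box (◆-rel r) = eval-≋ t (lock≋ (≋ₑ-trans (wkE-id (≋ₑ-reflˡ r)) (≋ₑ-trans r (≋ₑ-sym (evalSub-idₛ (≋ₑ-reflʳ r))))))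

eval-□-η : ∀ {W Γ A} (t : Tm Γ (□ A)) {ρ ρ' : Env W Γ} → ρ ≋ₑ ρ' →
           [ □ A ] eval t ρ ≋ eval (box (unbox t (lock nil))) ρ'
eval-□-η {A = A} t {ρ} {ρ'} p =
  (λ o e → ≋-trans A (proj₁ (eval-≋ t p) o e) (η-expanded o e)) ,
  uniform□ (eval-≋ t (≋ₑ-reflˡ p)) , eval-box-uniform (unbox t (lock nil)) (≋ₑ-reflʳ p)
  where
  η-expanded : ∀ {W' Δ} (o : W' ≤ _) (e : W' ◁ Δ) → [ A ] eval t ρ' o e ≋ eval t (wkE o ρ') idOPE (nil ∙ e)
  η-expanded o e =
    subst (λ x → [ A ] eval t ρ' o e ≋ eval t (wkE o ρ') idOPE x) (sym (∙-identityˡ e))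
          (subst (λ o' → [ A ] eval t ρ' o' e ≋ eval t (wkE o ρ') idOPE e) (●-identityˡ o)
                 (proj₁ (eval-wkE t o (≋ₑ-reflʳ p)) idOPE e))

eval-shift-unbox : ∀ {W Γ Θ Δ A} (t : Tm Δ (□ A)) (e : Δ ◁ Θ) (lf : LockFree e) (e' : Θ ◁ Γ)
                   {ρ ρ' : Env W Γ} → ρ ≋ₑ ρ' →
                   [ A ] eval (unbox t (e ∙ e')) ρ ≋ eval (unbox (wk (toOPE e lf) t) e') ρ'
eval-shift-unbox {A = A} t e lf e' {ρ} {ρ'} p =
  subst (λ g → [ A ] eval t (val g) idOPE (acc g) ≋ eval (unbox (wk o t) e') ρ') (sym shifted)
        (unbox-shift (factorEnv-≋ₑ p e'))
  where
  o = toOPE e lf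
  m = factorEnv e' ρ
  shifted : factorEnv (e ∙ e') ρ ≡ (prjEnv o (val m) ,◁ (nil ∙ acc m))
  shifted = trans (factorEnv-∙ e e' ρ) (cong (_◆∙ acc m) (factorEnv-LockFree e lf (val m)))
  unbox-shift : ∀ {g g'} → ◆-Rel _≋ₑ_ g g' →
                [ A ] eval t (prjEnv o (val g)) idOPE (nil ∙ acc g) ≋ eval (wk o t) (val g') idOPE (acc g')
  unbox-shift (◆-rel {p = σ} {σ'} {x = x} r) =
    subst (λ y → [ A ] eval t (prjEnv o σ) idOPE y ≋ eval (wk o t) σ' idOPE x) (sym (∙-identityˡ x))
          (≋-sym A (proj₁ (eval-wk o t (≋ₑ-sym r)) idOPE x))

eval-≈ : ∀ {W Γ A} {t u : Tm Γ A} → t ≈ u → {ρ ρ' : Env W Γ} → ρ ≋ₑ ρ' → [ A ] eval t ρ ≋ eval u ρ'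
eval-≈ {t = t} ≈-refl            p = eval-≋ t p
eval-≈ {A = A} (≈-sym q)         p = ≋-sym A (eval-≈ q (≋ₑ-sym p))
eval-≈ {A = A} (≈-trans q q')    p = ≋-trans A (eval-≈ q (≋ₑ-reflˡ p)) (eval-≈ q' p)
eval-≈ (cong-lam {t = t} {t'} q) p =
  (λ o r → eval-≈ q (wkE-≋ₑ o p ∷≋ r)) , eval-lam-uniform t (≋ₑ-reflˡ p) , eval-lam-uniform t' (≋ₑ-reflʳ p)
eval-≈ (cong-app q q')           p = proj₁ (eval-≈ q p) idOPE (eval-≈ q' p)
eval-≈ (cong-box {t = t} {t'} q) p =
  (λ o e → eval-≈ q (lock≋ (wkE-≋ₑ o p))) , eval-box-uniform t (≋ₑ-reflˡ p) , eval-box-uniform t' (≋ₑ-reflʳ p)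
eval-≈ {A = A} (cong-unbox {t = t} {t'} {e = e} q) p = unbox-≈ (factorEnv-≋ₑ p e)
  where
  unbox-≈ : ∀ {g g'} → ◆-Rel _≋ₑ_ g g' → [ A ] eval t (val g) idOPE (acc g) ≋ eval t' (val g') idOPE (acc g')
  unbox-≈ (◆-rel {x = x} r) = proj₁ (eval-≈ q r) idOPE x
eval-≈ (⇒-β t u)                 p = eval-⇒-β t u p
eval-≈ (⇒-η t)                   p = eval-⇒-η t p
eval-≈ (□-β t e)                 p = eval-□-β t e p
eval-≈ (□-η t)                   p = eval-□-η t p
eval-≈ (shift-unbox t e lf e')   p = eval-shift-unbox t e lf e' p

idEnv : ∀ {Γ} → Env Γ Γ
idEnv {·}      = []ₑ
idEnv {Γ `, A} = wkE (drop idOPE) idEnv ∷ₑ reflect A (var zero)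
idEnv {Γ `,🔒} = lockₑ idEnv (lock nil)

idEnv-≋ₑ : ∀ {Γ} → idEnv {Γ} ≋ₑ idEnv
idEnv-≋ₑ {·}      = []≋
idEnv-≋ₑ {Γ `, A} = wkE-≋ₑ (drop idOPE) idEnv-≋ₑ ∷≋ reflect-≋ A (var zero)
idEnv-≋ₑ {Γ `,🔒} = lock≋ idEnv-≋ₑ

nf : ∀ {Γ A} → Tm Γ A → Tm Γ A
nf {A = A} t = reify A (eval t idEnv)

nf-cong : ∀ {Γ A} {t u : Tm Γ A} → t ≈ u → nf t ≡ nf u
nf-cong {A = A} q = reify-≋ A (eval-≈ q idEnv-≋ₑ)

-- Soundness

app-lam-[] : ∀ {Γ' Γ Δ A B} (t : Tm (Δ `, A) B) (s : Sub Γ Δ) (o : Γ' ≤ Γ) (u : Tm Γ' A) →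
             app (wk o (lam t [ s ])) u ≈ t [ wkSub o s ,ₛ u ]
app-lam-[] t s o u = begin
  app (lam (wk (keep o) (t [ s↑ ]))) u           ≈⟨ ⇒-β _ _ ⟩
  wk (keep o) (t [ s↑ ]) [ idₛ ,ₛ u ]            ≡⟨ []-wk (keep o) (t [ s↑ ]) _ ⟩
  t [ s↑ ] [ prj o idₛ ,ₛ u ]                    ≡⟨ []-⊛ t s↑ _ ⟩
  t [ (wkSub (drop idOPE) s ⊛ (prj o idₛ ,ₛ u)) ,ₛ u ] ≡⟨ cong (λ σ → t [ σ ,ₛ u ]) weakened ⟩
  t [ wkSub o (s ⊛ idₛ) ,ₛ u ]                   ≈⟨ []-cong t (≈ₛ-ext (≈ₛ-wk o (⊛-identityʳ s)) ≈-refl) ⟩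
  t [ wkSub o s ,ₛ u ]                           ∎
  where
  open ≈-Reasoning
  s↑ = wkSub (drop idOPE) s ,ₛ var zero
  weakened : wkSub (drop idOPE) s ⊛ (prj o idₛ ,ₛ u) ≡ wkSub o (s ⊛ idₛ)
  weakened = trans (wkSub-⊛ (drop idOPE) s _) (trans (cong (s ⊛_) (trans (prj-id _) (prj-idₛ o))) (⊛-wkSub o s idₛ))

unbox-box-[] : ∀ {Γ' Γ Δ Θ A} (t : Tm (Δ `,🔒) A) (s : Sub Γ Δ) (o : Γ' ≤ Γ) (e : Γ' ◁ Θ) →
               unbox (wk o (box t [ s ])) e ≈ t [ lock (wkSub o s) e ]
unbox-box-[] t s o e = begin
  unbox (box (wk (keep🔒 o) T)) e          ≈⟨ □-β _ _ ⟩
  wk (keep🔒 o) T [ lock idₛ e ]           ≡⟨ []-wk (keep🔒 o) T _ ⟩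
  T [ lock (prj o idₛ) e ]                ≡⟨ []-⊛ t (lock s (lock nil)) _ ⟩
  t [ lock (s ⊛ prj o idₛ) (nil ∙ e) ]    ≡⟨ cong₂ (λ σ x → t [ lock σ x ]) weakened (∙-identityˡ e) ⟩
  t [ lock (wkSub o (s ⊛ idₛ)) e ]        ≈⟨ []-cong t (≈ₛ-lock (≈ₛ-wk o (⊛-identityʳ s))) ⟩
  t [ lock (wkSub o s) e ]                ∎
  where
  open ≈-Reasoning
  T = t [ lock s (lock nil) ]
  weakened : s ⊛ prj o idₛ ≡ wkSub o (s ⊛ idₛ)
  weakened = trans (cong (s ⊛_) (prj-idₛ o)) (⊛-wkSub o s idₛ)

infix 4 [_]_∼_
[_]_∼_ : ∀ A {Γ} → Tm Γ A → ⟦ A ⟧ Γ → Set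
[ ι ]     t ∼ n = t ≈ n
[ A ⇒ B ] t ∼ f = ∀ {Γ'} (o : Γ' ≤ _) {u a} → [ A ] u ∼ a → [ B ] app (wk o t) u ∼ f o a
[ □ A ]   t ∼ f = ∀ {Γ' Δ} (o : Γ' ≤ _) (e : Γ' ◁ Δ) → [ A ] unbox (wk o t) e ∼ f o e

≈-∼ : ∀ A {Γ} {t t' : Tm Γ A} {a} → t ≈ t' → [ A ] t ∼ a → [ A ] t' ∼ a
≈-∼ ι       q r = ≈-trans (≈-sym q) r
≈-∼ (A ⇒ B) q r = λ o r' → ≈-∼ B (cong-app (≈-wk o q) ≈-refl) (r o r')
≈-∼ (□ A)   q r = λ o e → ≈-∼ A (cong-unbox (≈-wk o q)) (r o e)

∼-wk : ∀ A {Γ' Γ} (o : Γ' ≤ Γ) {t : Tm Γ A} {a} → [ A ] t ∼ a → [ A ] wk o t ∼ wkV A o a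
∼-wk ι       o         r = ≈-wk o r
∼-wk (A ⇒ B) o {t} {f} r = λ o' {u} {a} r' → subst (λ t' → [ B ] app t' u ∼ f (o' ● o) a) (wk-● o' o t) (r (o' ● o) r')
∼-wk (□ A)   o {t} {f} r = λ o' e → subst (λ t' → [ A ] unbox t' e ∼ f (o' ● o) e) (wk-● o' o t) (r (o' ● o) e)

reflect-∼ : ∀ A {Γ} (t : Tm Γ A) → [ A ] t ∼ reflect A t
reify-∼   : ∀ A {Γ} {t : Tm Γ A} {a} → [ A ] t ∼ a → t ≈ reify A a
reflect-∼ ι       t = ≈-refl
reflect-∼ (A ⇒ B) t = λ o {u} {a} r →
  ≈-∼ B (cong-app ≈-refl (≈-sym (reify-∼ A r))) (reflect-∼ B (app (wk o t) (reify A a)))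
reflect-∼ (□ A)   t = λ o e → reflect-∼ A (unbox (wk o t) e)
reify-∼ ι       r = r
reify-∼ (A ⇒ B) {t = t} r = ≈-trans (⇒-η t) (cong-lam (reify-∼ B (r (drop idOPE) (reflect-∼ A (var zero)))))
reify-∼ (□ A)   {t = t} {f} r =
  ≈-trans (□-η t) (cong-box (subst (λ t' → unbox t' (lock nil) ≈ reify A (f idOPE (lock nil)))
                                   (wk-id t) (reify-∼ A (r idOPE (lock nil)))))

infix 4 _∼ₛ_
data _∼ₛ_ : ∀ {Γ Δ} → Sub Γ Δ → Env Γ Δ → Set where
  []∼   : ∀ {Γ} → empty {Γ} ∼ₛ []ₑ
  _∷∼_  : ∀ {Γ Δ A} {s : Sub Γ Δ} {ρ} {t : Tm Γ A} {a} → s ∼ₛ ρ → [ A ] t ∼ a → (s ,ₛ t) ∼ₛ (ρ ∷ₑ a)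
  lock∼ : ∀ {Γ Θ Δ} {s : Sub Θ Δ} {ρ} {e : Θ ◁ Γ} → s ∼ₛ ρ → lock s e ∼ₛ lockₑ ρ e

∼ₛ-wk : ∀ {Γ' Γ Δ} (o : Γ' ≤ Γ) {s : Sub Γ Δ} {ρ} → s ∼ₛ ρ → wkSub o s ∼ₛ wkE o ρ
∼ₛ-wk o []∼                 = []∼
∼ₛ-wk o (_∷∼_ {A = A} p r)  = ∼ₛ-wk o p ∷∼ ∼-wk A o r
∼ₛ-wk o (lock∼ {e = e} p)   = lock∼ (∼ₛ-wk (factorWk o e) p)

substVar-∼ : ∀ {Γ Δ A} (v : Var Δ A) {s : Sub Γ Δ} {ρ} → s ∼ₛ ρ → [ A ] substVar v s ∼ lookup v ρ
substVar-∼ zero     (p ∷∼ r) = r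
substVar-∼ (succ v) (p ∷∼ r) = substVar-∼ v p

factor-∼ₛ : ∀ {Γ Δ Δ₀} {s : Sub Γ Δ} {ρ} → s ∼ₛ ρ → (e : Δ₀ ◁ Δ) → ◆-Rel _∼ₛ_ (factorS e s) (factorEnv e ρ)
factor-∼ₛ p                  nil      = ◆-rel p
factor-∼ₛ (p ∷∼ r)           (ext e)  = factor-∼ₛ p e
factor-∼ₛ (lock∼ {e = e'} p) (lock e) = ◆-Rel-∙ e' (factor-∼ₛ p e)

fundamental : ∀ {Γ Δ A} (t : Tm Δ A) {s : Sub Γ Δ} {ρ : Env Γ Δ} → s ∼ₛ ρ → [ A ] t [ s ] ∼ eval t ρ
fundamental (var v) p = substVar-∼ v p
fundamental {A = A ⇒ B} (lam t) {s} p = λ o {u} r →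
  ≈-∼ B (≈-sym (app-lam-[] t s o u)) (fundamental t (∼ₛ-wk o p ∷∼ r))
fundamental {A = B} (app t u) {s} {ρ} p =
  subst (λ t' → [ B ] app t' (u [ s ]) ∼ eval t ρ idOPE (eval u ρ)) (wk-id (t [ s ]))
        (fundamental t p idOPE (fundamental u p))
fundamental {A = □ A} (box t) {s} p = λ o e →
  ≈-∼ A (≈-sym (unbox-box-[] t s o e)) (fundamental t (lock∼ (∼ₛ-wk o p)))
fundamental {A = A} (unbox t e) p = unbox-∼ (factor-∼ₛ p e)
  where
  unbox-∼ : ∀ {h g} → ◆-Rel _∼ₛ_ h g → [ A ] unboxSub h t ∼ eval t (val g) idOPE (acc g)
  unbox-∼ (◆-rel {p = σ} {ρ} {x} q) =
    subst (λ t' → [ A ] unbox t' x ∼ eval t ρ idOPE x) (wk-id (t [ σ ])) (fundamental t q idOPE x)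

idₛ-∼ₛ : ∀ {Γ} → idₛ {Γ} ∼ₛ idEnv
idₛ-∼ₛ {·}      = []∼
idₛ-∼ₛ {Γ `, A} = ∼ₛ-wk (drop idOPE) idₛ-∼ₛ ∷∼ reflect-∼ A (var zero)
idₛ-∼ₛ {Γ `,🔒} = lock∼ idₛ-∼ₛ

nf-sound : ∀ {Γ A} (t : Tm Γ A) → t ≈ nf t
nf-sound {A = A} t = ≈-trans (≈-sym ([]-idₛ t)) (reify-∼ A (fundamental t idₛ-∼ₛ))

-- Decidability

_≟Ty_ : (A B : Ty) → Dec (A ≡ B)
ι       ≟Ty ι         = yes refl
ι       ≟Ty (B ⇒ B')  = no λ ()
ι       ≟Ty (□ B)     = no λ ()
(A ⇒ A') ≟Ty ι        = no λ ()
(A ⇒ A') ≟Ty (B ⇒ B') with A ≟Ty B | A' ≟Ty B'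
... | yes refl | yes refl = yes refl
... | no A≢B   | _        = no λ { refl → A≢B refl }
... | yes _    | no A'≢B' = no λ { refl → A'≢B' refl }
(A ⇒ A') ≟Ty (□ B)    = no λ ()
(□ A)   ≟Ty ι         = no λ ()
(□ A)   ≟Ty (B ⇒ B')  = no λ ()
(□ A)   ≟Ty (□ B)     with A ≟Ty B
... | yes refl = yes refl
... | no A≢B   = no λ { refl → A≢B refl }

_≟Ctx_ : (Γ Δ : Ctx) → Dec (Γ ≡ Δ)
·        ≟Ctx ·        = yes refl
·        ≟Ctx (Δ `, B) = no λ ()
·        ≟Ctx (Δ `,🔒)  = no λ ()
(Γ `, A) ≟Ctx ·        = no λ ()
(Γ `, A) ≟Ctx (Δ `, B) with Γ ≟Ctx Δ | A ≟Ty B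
... | yes refl | yes refl = yes refl
... | no Γ≢Δ   | _        = no λ { refl → Γ≢Δ refl }
... | yes _    | no A≢B   = no λ { refl → A≢B refl }
(Γ `, A) ≟Ctx (Δ `,🔒)  = no λ ()
(Γ `,🔒)  ≟Ctx ·        = no λ ()
(Γ `,🔒)  ≟Ctx (Δ `, B) = no λ ()
(Γ `,🔒)  ≟Ctx (Δ `,🔒)  with Γ ≟Ctx Δ
... | yes refl = yes refl
... | no Γ≢Δ   = no λ { refl → Γ≢Δ refl }

_≟Var_ : ∀ {Γ A} (v w : Var Γ A) → Dec (v ≡ w)
zero   ≟Var zero   = yes refl
zero   ≟Var succ w = no λ ()
succ v ≟Var zero   = no λ ()
succ v ≟Var succ w with v ≟Var w
... | yes refl = yes refl
... | no v≢w   = no λ { refl → v≢w refl }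

_≟◁_ : ∀ {Δ Γ} (e e' : Δ ◁ Γ) → Dec (e ≡ e')
nil    ≟◁ nil     = yes refl
nil    ≟◁ ext e'  = no λ ()
nil    ≟◁ lock e' = no λ ()
ext e  ≟◁ nil     = no λ ()
ext e  ≟◁ ext e'  with e ≟◁ e'
... | yes refl = yes refl
... | no e≢e'  = no λ { refl → e≢e' refl }
lock e ≟◁ nil     = no λ ()
lock e ≟◁ lock e' with e ≟◁ e'
... | yes refl = yes refl
... | no e≢e'  = no λ { refl → e≢e' refl }

_≟Tm_ : ∀ {Γ A} (t u : Tm Γ A) → Dec (t ≡ u)
var v     ≟Tm var w     with v ≟Var w
... | yes refl = yes refl
... | no v≢w   = no λ { refl → v≢w refl }
var v     ≟Tm lam u     = no λ ()
var v     ≟Tm app u u'  = no λ ()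
var v     ≟Tm box u     = no λ ()
var v     ≟Tm unbox u e = no λ ()
lam t     ≟Tm var w     = no λ ()
lam t     ≟Tm lam u     with t ≟Tm u
... | yes refl = yes refl
... | no t≢u   = no λ { refl → t≢u refl }
lam t     ≟Tm app u u'  = no λ ()
lam t     ≟Tm unbox u e = no λ ()
app t t'  ≟Tm var w     = no λ ()
app t t'  ≟Tm lam u     = no λ ()
app {A = A} t t' ≟Tm app {A = B} u u' with A ≟Ty B
... | no A≢B   = no λ { refl → A≢B refl }
... | yes refl with t ≟Tm u | t' ≟Tm u'
...   | yes refl | yes refl = yes refl
...   | no t≢u   | _        = no λ { refl → t≢u refl }
...   | yes _    | no t'≢u' = no λ { refl → t'≢u' refl }
app t t'  ≟Tm box u     = no λ ()
app t t'  ≟Tm unbox u e = no λ ()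
box t     ≟Tm var w     = no λ ()
box t     ≟Tm app u u'  = no λ ()
box t     ≟Tm box u     with t ≟Tm u
... | yes refl = yes refl
... | no t≢u   = no λ { refl → t≢u refl }
box t     ≟Tm unbox u e = no λ ()
unbox t e ≟Tm var w     = no λ ()
unbox t e ≟Tm lam u     = no λ ()
unbox t e ≟Tm app u u'  = no λ ()
unbox t e ≟Tm box u     = no λ ()
unbox {Δ = Δ} t e ≟Tm unbox {Δ = Δ'} u e' with Δ ≟Ctx Δ'
... | no Δ≢Δ'  = no λ { refl → Δ≢Δ' refl }
... | yes refl with t ≟Tm u | e ≟◁ e'
...   | yes refl | yes refl = yes refl
...   | no t≢u   | _        = no λ { refl → t≢u refl }
...   | yes _    | no e≢e'  = no λ { refl → e≢e' refl }

nf-injective : ∀ {Γ A} {t u : Tm Γ A} → nf t ≡ nf u → t ≈ u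
nf-injective {t = t} {u} p = ≈-trans (nf-sound t) (≈-trans (≡⇒≈ p) (≈-sym (nf-sound u)))

theorem4p6 : ∀ {Γ A} (t u : Tm Γ A) → Dec (t ≈ u)
theorem4p6 t u = map′ nf-injective nf-cong (nf t ≟Tm nf u)
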